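{- Let $g=a_{\tau_1}a_{\tau_2}\cdots a_{\tau_d}$ be a square-free monomial (a simple graph on $\{1,\dots,n\}$ with $d$ edges $\tau_1,\dots,\tau_d$). Then $$I(\overline g):=\sum_{\rho\in S_n/\mathrm{Stab}(g)}(1-a_{\rho(\tau_1)})(1-a_{\rho(\tau_2)})\cdots(1-a_{\rho(\tau_d)})=\sum_{a\subseteq g}(-1)^{|a|}\frac{I(a)(g)\,|\mathrm{Stab}(a)|}{|\mathrm{Stab}(g)|}\,I(a),$$ where the sum on the right runs over the isomorphism classes (under $S_n$) of subgraphs $a$ of $g$, including the empty graph, and $|a|$ is the number of edges of $a$.
   Context: Variables $a_{ij}=a_{ji}$, $1\le i<j\le n$; $S_n$ acts by $\rho(a_{ij})=a_{\rho(i)\rho(j)}$ (for an edge $\tau=\{i,j\}$, $a_{\rho(\tau)}=a_{\rho(i)\rho(j)}$). For a monomial $M$, $\mathrm{Stab}(M)=\{\rho\in S_n:\rho(M)=M\}$ and $I(M)=\sum_{\rho\in S_n/\mathrm{Stab}(M)}\rho(M)$, with $I(1)=1$ and $\mathrm{Stab}(1)=S_n$ for the empty graph. A subgraph of $g$ is a product of a subset of the variables of $g$. $I(a)(g)$ is the number of subgraphs of $g$ lying in the $S_n$-orbit of $a$ (the number of subgraphs of $g$ isomorphic to $a$). -}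

module Defs where

open import Data.Bool using (Bool; true; false; _∧_; _∨_; not; T)
open import Data.Nat using (ℕ; zero; suc; _/_) renaming (_*_ to _*ℕ_)
open import Data.Fin using (Fin; _≟_)
open import Data.Product using (_×_; _,_; proj₁; proj₂)
open import Data.List using (List; []; _∷_; [_]; map; concatMap; filterᵇ; deduplicateᵇ; allFin; length; foldr)
open import Data.Bool.ListAction using (any; all)
open import Data.Vec using (Vec; lookup) renaming ([] to []ᵥ; _∷_ to _∷ᵥ_)
open import Relation.Nullary.Decidable using (⌊_⌋)
open import Algebra.Bundles using (CommutativeRing)

-- An (ordered representative of an unordered) pair of vertices; the edge {i,j}.
Pair : ℕ → Set
Pair n = Fin n × Fin n

_==_ : ∀ {n} → Fin n → Fin n → Bool
i == j = ⌊ i ≟ j ⌋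

sameEdgeᵇ : ∀ {n} → Pair n → Pair n → Bool
sameEdgeᵇ (i , j) (k , l) = ((i == k) ∧ (j == l)) ∨ ((i == l) ∧ (j == k))

-- a (square-free) monomial / simple graph given by its list of edges
Graph : ℕ → Set
Graph n = List (Pair n)

memᵇ : ∀ {n} → Pair n → Graph n → Bool
memᵇ e G = any (sameEdgeᵇ e) G

sameGraphᵇ : ∀ {n} → Graph n → Graph n → Bool
sameGraphᵇ G H = all (λ e → memᵇ e H) G ∧ all (λ e → memᵇ e G) H

vecs : ∀ {A : Set} → List A → (k : ℕ) → List (Vec A k)
vecs xs zero = [ []ᵥ ]
vecs xs (suc k) = concatMap (λ x → map (x ∷ᵥ_) (vecs xs k)) xs

maps : (n : ℕ) → List (Fin n → Fin n)
maps n = map lookup (vecs (allFin n) n)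

injectiveᵇ : ∀ {n} → (Fin n → Fin n) → Bool
injectiveᵇ {n} ρ = all (λ i → all (λ j → not (ρ i == ρ j) ∨ (i == j)) (allFin n)) (allFin n)

symmetricGroup : (n : ℕ) → List (Fin n → Fin n)
symmetricGroup n = filterᵇ injectiveᵇ (maps n)

act : ∀ {n} → (Fin n → Fin n) → Graph n → Graph n
act ρ G = map (λ e → ρ (proj₁ e) , ρ (proj₂ e)) G

stabilizer : ∀ {n} → Graph n → List (Fin n → Fin n)
stabilizer {n} G = filterᵇ (λ ρ → sameGraphᵇ (act ρ G) G) (symmetricGroup n)

-- a set of representatives of S_n / Stab(G) (first element of each left coset ρ Stab(G))
cosetReps : ∀ {n} → Graph n → List (Fin n → Fin n)
cosetReps {n} G = deduplicateᵇ (λ ρ σ → sameGraphᵇ (act ρ G) (act σ G)) (symmetricGroup n)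

isomorphicᵇ : ∀ {n} → Graph n → Graph n → Bool
isomorphicᵇ {n} G H = any (λ ρ → sameGraphᵇ (act ρ G) H) (symmetricGroup n)

edgesOf : ∀ {n d} → (Fin d → Pair n) → Graph n
edgesOf {d = d} τ = map τ (allFin d)

subgraphs : ∀ {n d} → (Fin d → Pair n) → List (Graph n)
subgraphs {d = d} τ = map (λ S → map τ (filterᵇ (lookup S) (allFin d))) (vecs (true ∷ false ∷ []) d)

-- I(a)(g): the number of subgraphs of g in the S_n-orbit of a
countIso : ∀ {n d} → Graph n → (Fin d → Pair n) → ℕ
countIso a τ = length (filterᵇ (isomorphicᵇ a) (subgraphs τ))

isoClassReps : ∀ {n d} → (Fin d → Pair n) → List (Graph n)
isoClassReps τ = deduplicateᵇ isomorphicᵇ (subgraphs τ)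

-- natural-number division (the divisor below, |Stab(g)|, is always ≥ 1)
divℕ : ℕ → ℕ → ℕ
divℕ m zero = zero
divℕ m (suc k) = m / suc k

-- Polynomial expressions, evaluated in an arbitrary commutative ring R at an
-- arbitrary symmetric assignment x i j = a_{ij} of the variables.
module WithRing {c ℓ} (R : CommutativeRing c ℓ) where
  open CommutativeRing R
  open import Algebra.Definitions.RawMonoid +-rawMonoid using () renaming (_×_ to _·_)

  sumR : List Carrier → Carrier
  sumR = foldr _+_ 0#

  monomial : ∀ {n} → (Fin n → Fin n → Carrier) → Graph n → Carrier
  monomial x G = foldr (λ e r → x (proj₁ e) (proj₂ e) * r) 1# G

  I : ∀ {n} → (Fin n → Fin n → Carrier) → Graph n → Carrier
  I x G = sumR (map (λ ρ → monomial x (act ρ G)) (cosetReps G))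

  Ibar : ∀ {n d} → (Fin n → Fin n → Carrier) → (Fin d → Pair n) → Carrier
  Ibar x τ = sumR (map (λ ρ → foldr (λ e r → (1# + - x (ρ (proj₁ e)) (ρ (proj₂ e))) * r) 1# (edgesOf τ))
                       (cosetReps (edgesOf τ)))

  signed : ℕ → Carrier → Carrier
  signed zero y = y
  signed (suc k) y = - signed k y

  rhs : ∀ {n d} → (Fin n → Fin n → Carrier) → (Fin d → Pair n) → Carrier
  rhs x τ = sumR (map (λ a → signed (length a)
                        (divℕ (countIso a τ *ℕ length (stabilizer a)) (length (stabilizer (edgesOf τ))) · I x a))
                      (isoClassReps τ))

-- Expanding every product ∏ₖ (1 - a_{ρ(τₖ)}) writes I(ḡ) as a signed sum of the monomials ρ(b),
-- ρ running over coset representatives of Stab(g) and b over the subgraphs of g; the sign only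
-- depends on the number of edges. Collect equal monomials: the monomial σ(a), for a a class
-- representative and σ a coset representative of Stab(a), occurs N = #{(ρ, b) : ρ(b) = σ(a)} times.
-- Double counting over Sₙ gives N · |Stab(g)| = #{π : σ(a) ⊆ π(g)} = Σ_b #{π : π(b) = σ(a)}
-- = I(a)(g) · |Stab(a)|: the condition σ(a) ⊆ π(g) is constant on the cosets π Stab(g), a subgraph
-- of π(g) is π(b) for exactly one b, and each subgraph b ≅ a of g is carried onto σ(a) by exactly
-- |Stab(a)| permutations.

module Submission where

open import Algebra.Bundles using (CommutativeMonoid; CommutativeRing)
open import Data.Bool using (Bool; true; false; _∧_; _∨_; not; T)
import Data.Bool as Bool
open import Data.Bool.ListAction using (all; any)
open import Data.Bool.Properties using (T-≡; T-∧; T-∨)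
open import Data.Empty using (⊥-elim)
open import Data.Fin using (Fin; zero; suc; _≟_; punchOut)
open import Data.Fin.Properties using (suc-injective; any?; punchOut-injective; injective⇒≤)
open import Data.List using (List; []; _∷_; map; concatMap; filter; filterᵇ; deduplicateᵇ; length; _++_; allFin; foldr)
open import Data.List.Properties using (map-tabulate; map-∘; map-cong; foldr-map; length-map)
open import Data.List.Membership.Propositional using (_∈_; find; lose)
open import Data.List.Membership.Propositional.Properties
  using (∈-map⁺; ∈-map⁻; ∈-++⁺ʳ; ∈-deduplicate⁻; ∈-concatMap⁻; ∈-allFin; ∈-filter⁺; ∈-filter⁻)
import Data.List.Relation.Unary.All as All
open import Data.List.Relation.Unary.All.Properties using (all⁺; all⁻)
open import Data.List.Relation.Unary.AllPairs using (AllPairs; []; _∷_) renaming (tail to AllPairs-tail)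
import Data.List.Relation.Unary.AllPairs as AllPairs
import Data.List.Relation.Unary.AllPairs.Properties as AllPairs
open import Data.List.Relation.Unary.Any using (here; there)
import Data.List.Relation.Unary.Any as Any
open import Data.List.Relation.Unary.Any.Properties using (any⁺; any⁻)
open import Data.List.Relation.Unary.Unique.Propositional.Properties using (allFin⁺; filter⁺)
open import Data.Nat using (ℕ; zero; suc; _≤_; _<_; z≤n; s≤s)
import Data.Nat as ℕ
open import Data.Product using (∃; _×_; _,_; proj₁; proj₂)
open import Data.Sum using (inj₁; inj₂)
open import Data.Unit using (tt)
open import Data.Vec using (Vec; lookup; tabulate) renaming ([] to []ᵥ; _∷_ to _∷ᵥ_)
import Data.Vec.Properties as Vecₚ
open import Data.Vec.Properties using (lookup∘tabulate; tabulate∘lookup; tabulate-cong)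
open import Defs
open import Function using (_∘_; id)
open import Function.Bundles using (Equivalence)
open import Function.Definitions using (Injective)
open import Relation.Binary.Definitions using (DecidableEquality)
open import Relation.Binary.PropositionalEquality
  using (_≡_; _≢_; refl; sym; trans; cong; cong₂; subst; _≗_; module ≡-Reasoning)
open import Relation.Nullary using (¬_; Dec; yes; no; does)
open import Relation.Nullary.Decidable using (⌊_⌋; toWitness; fromWitness; T?; map′)
open import Relation.Unary using (Pred; Decidable)

-- Finite sums and enumerations

module ListSum {c ℓ} (M : CommutativeMonoid c ℓ) where
  open CommutativeMonoid M renaming (Carrier to C; refl to ≈-refl; sym to ≈-sym; trans to ≈-trans)
  open import Algebra.Properties.CommutativeSemigroup commutativeSemigroup using (interchange)

  ∑ : {A : Set} → List A → (A → C) → C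
  ∑ [] f = ε
  ∑ (x ∷ xs) f = f x ∙ ∑ xs f

  module _ {A : Set} where
    ∑-cong-∈ : (xs : List A) {f g : A → C} → (∀ {x} → x ∈ xs → f x ≈ g x) → ∑ xs f ≈ ∑ xs g
    ∑-cong-∈ [] f≈g = ≈-refl
    ∑-cong-∈ (x ∷ xs) f≈g = ∙-cong (f≈g (here refl)) (∑-cong-∈ xs (f≈g ∘ there))

    ∑-cong : (xs : List A) {f g : A → C} → (∀ x → f x ≈ g x) → ∑ xs f ≈ ∑ xs g
    ∑-cong xs f≈g = ∑-cong-∈ xs (λ {x} _ → f≈g x)

    ∑-++ : (xs ys : List A) (f : A → C) → ∑ (xs ++ ys) f ≈ ∑ xs f ∙ ∑ ys f
    ∑-++ [] ys f = ≈-sym (identityˡ _)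
    ∑-++ (x ∷ xs) ys f = ≈-trans (∙-congˡ (∑-++ xs ys f)) (≈-sym (assoc _ _ _))

    ∑-ε : (xs : List A) → ∑ xs (λ _ → ε) ≈ ε
    ∑-ε [] = ≈-refl
    ∑-ε (x ∷ xs) = ≈-trans (identityˡ _) (∑-ε xs)

    ∑-∙ : (xs : List A) (f g : A → C) → ∑ xs (λ x → f x ∙ g x) ≈ ∑ xs f ∙ ∑ xs g
    ∑-∙ [] f g = ≈-sym (identityˡ ε)
    ∑-∙ (x ∷ xs) f g = ≈-trans (∙-congˡ (∑-∙ xs f g)) (interchange _ _ _ _)

  module _ {A B : Set} where
    ∑-map : (h : A → B) (xs : List A) (f : B → C) → ∑ (map h xs) f ≈ ∑ xs (f ∘ h)
    ∑-map h [] f = ≈-refl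
    ∑-map h (x ∷ xs) f = ∙-congˡ (∑-map h xs f)

    ∑-concatMap : (h : A → List B) (xs : List A) (f : B → C) → ∑ (concatMap h xs) f ≈ ∑ xs (λ x → ∑ (h x) f)
    ∑-concatMap h [] f = ≈-refl
    ∑-concatMap h (x ∷ xs) f = ≈-trans (∑-++ (h x) (concatMap h xs) f) (∙-congˡ (∑-concatMap h xs f))

    ∑-comm : (xs : List A) (ys : List B) (f : A → B → C) → ∑ xs (λ x → ∑ ys (f x)) ≈ ∑ ys (λ y → ∑ xs (λ x → f x y))
    ∑-comm [] ys f = ≈-sym (∑-ε ys)
    ∑-comm (x ∷ xs) ys f = ≈-trans (∙-congˡ (∑-comm xs ys f)) (≈-sym (∑-∙ ys (f x) _))

module Combinatorics where
  open import Data.Nat using (_+_; _*_)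
  open import Data.Nat.DivMod using (m*n/n≡m)
  open import Data.Nat.Properties
    using (1+n≰n; +-0-commutativeMonoid; +-commutativeSemigroup; +-identityʳ; +-cancelˡ-≡; ≤-trans; ≤-reflexive;
           m≤m+n; m≤n+m; n≮0; *-distribʳ-+; *-distribˡ-+; *-zeroʳ; *-identityʳ)
  open import Algebra.Properties.CommutativeSemigroup +-commutativeSemigroup using (x∙yz≈y∙xz)

  open ListSum +-0-commutativeMonoid public

  𝟙 : Bool → ℕ
  𝟙 true = 1
  𝟙 false = 0

  𝟙-∧ : ∀ a b → 𝟙 (a ∧ b) ≡ 𝟙 a * 𝟙 b
  𝟙-∧ true b = sym (+-identityʳ (𝟙 b))
  𝟙-∧ false b = refl

  T-extensional : ∀ {a b : Bool} → (T a → T b) → (T b → T a) → a ≡ b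
  T-extensional {true} {true} _ _ = refl
  T-extensional {true} {false} to _ = ⊥-elim (to tt)
  T-extensional {false} {true} _ from = ⊥-elim (from tt)
  T-extensional {false} {false} _ _ = refl

  ≡true : ∀ {a} → T a → a ≡ true
  ≡true = Equivalence.to T-≡

  ≡false : ∀ {a} → ¬ T a → a ≡ false
  ≡false {true} ¬t = ⊥-elim (¬t tt)
  ≡false {false} _ = refl

  module _ {A : Set} where
    ∑-*ˡ : (xs : List A) (f : A → ℕ) (c : ℕ) → ∑ xs (λ x → c * f x) ≡ c * ∑ xs f
    ∑-*ˡ [] f c = sym (*-zeroʳ c)
    ∑-*ˡ (x ∷ xs) f c = trans (cong (c * f x +_) (∑-*ˡ xs f c)) (sym (*-distribˡ-+ c (f x) (∑ xs f)))

    ∑-*ʳ : (xs : List A) (f : A → ℕ) (c : ℕ) → ∑ xs (λ x → f x * c) ≡ ∑ xs f * c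
    ∑-*ʳ [] f c = refl
    ∑-*ʳ (x ∷ xs) f c = trans (cong (f x * c +_) (∑-*ʳ xs f c)) (sym (*-distribʳ-+ c (f x) (∑ xs f)))

    ∑-≤ : (xs : List A) (f : A → ℕ) {x : A} → x ∈ xs → f x ≤ ∑ xs f
    ∑-≤ (y ∷ xs) f (here refl) = m≤m+n (f y) _
    ∑-≤ (y ∷ xs) f (there x∈xs) = ≤-trans (∑-≤ xs f x∈xs) (m≤n+m _ (f y))

    ∑-filter : ∀ {ℓ} {P : Pred A ℓ} (P? : Decidable P) (xs : List A) (f : A → ℕ) →
               ∑ (filter P? xs) f ≡ ∑ xs (λ x → 𝟙 (does (P? x)) * f x)
    ∑-filter P? [] f = refl
    ∑-filter P? (x ∷ xs) f with does (P? x)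
    ... | true = cong₂ _+_ (sym (+-identityʳ (f x))) (∑-filter P? xs f)
    ... | false = ∑-filter P? xs f

    length-filterᵇ : (p : A → Bool) (xs : List A) → length (filterᵇ p xs) ≡ ∑ xs (𝟙 ∘ p)
    length-filterᵇ p [] = refl
    length-filterᵇ p (x ∷ xs) with p x
    ... | true = cong suc (length-filterᵇ p xs)
    ... | false = length-filterᵇ p xs

  module Multiplicity {A : Set} (_≟ᴬ_ : DecidableEquality A) where

    occurrences : A → List A → ℕ
    occurrences w xs = ∑ xs (λ v → 𝟙 ⌊ v ≟ᴬ w ⌋)

    Enumerates : List A → Set
    Enumerates xs = ∀ w → occurrences w xs ≡ 1

    split-at : (w : A) (xs : List A) → 0 < occurrences w xs → ∃ λ ys → ∃ λ zs → xs ≡ ys ++ w ∷ zs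
    split-at w (x ∷ xs) pos with x ≟ᴬ w
    ... | yes refl = [] , xs , refl
    ... | no _ with split-at w xs pos
    ...   | ys , zs , refl = x ∷ ys , zs , refl

    occurs⇒∈ : {w : A} {xs : List A} → 0 < occurrences w xs → w ∈ xs
    occurs⇒∈ {w} {xs} pos with split-at w xs pos
    ... | ys , zs , refl = ∈-++⁺ʳ ys (here refl)

    Enumerates⇒∈ : {xs : List A} → Enumerates xs → ∀ w → w ∈ xs
    Enumerates⇒∈ enum w = occurs⇒∈ (subst (0 <_) (sym (enum w)) (s≤s z≤n))

    occurs-head : (x : A) (xs : List A) → 0 < occurrences x (x ∷ xs)
    occurs-head x xs with x ≟ᴬ x
    ... | yes _ = s≤s z≤n
    ... | no x≢x = ⊥-elim (x≢x refl)

    ∑-resp-occurrences : (xs ys : List A) → (∀ w → occurrences w xs ≡ occurrences w ys) → (f : A → ℕ) → ∑ xs f ≡ ∑ ys f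
    ∑-resp-occurrences [] [] _ f = refl
    ∑-resp-occurrences [] (y ∷ ys) occ f = ⊥-elim (n≮0 (subst (0 <_) (sym (occ y)) (occurs-head y ys)))
    ∑-resp-occurrences (x ∷ xs) ys occ f with split-at x ys (subst (0 <_) (occ x) (occurs-head x xs))
    ... | us , vs , refl = begin
      f x + ∑ xs f             ≡⟨ cong (f x +_) (∑-resp-occurrences xs (us ++ vs) occ′ f) ⟩
      f x + ∑ (us ++ vs) f     ≡⟨ cong (f x +_) (∑-++ us vs f) ⟩
      f x + (∑ us f + ∑ vs f)  ≡⟨ x∙yz≈y∙xz (f x) (∑ us f) (∑ vs f) ⟩
      ∑ us f + (f x + ∑ vs f)  ≡⟨ sym (∑-++ us (x ∷ vs) f) ⟩
      ∑ (us ++ x ∷ vs) f       ∎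
      where
      open ≡-Reasoning
      occ′ : ∀ w → occurrences w xs ≡ occurrences w (us ++ vs)
      occ′ w = +-cancelˡ-≡ (𝟙 ⌊ x ≟ᴬ w ⌋) _ _ (begin
        𝟙 ⌊ x ≟ᴬ w ⌋ + occurrences w xs
          ≡⟨ occ w ⟩
        occurrences w (us ++ x ∷ vs)
          ≡⟨ ∑-++ us (x ∷ vs) _ ⟩
        occurrences w us + (𝟙 ⌊ x ≟ᴬ w ⌋ + occurrences w vs)
          ≡⟨ x∙yz≈y∙xz (occurrences w us) (𝟙 ⌊ x ≟ᴬ w ⌋) (occurrences w vs) ⟩
        𝟙 ⌊ x ≟ᴬ w ⌋ + (occurrences w us + occurrences w vs)
          ≡⟨ cong (𝟙 ⌊ x ≟ᴬ w ⌋ +_) (sym (∑-++ us vs _)) ⟩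
        𝟙 ⌊ x ≟ᴬ w ⌋ + occurrences w (us ++ vs) ∎)

    ∑-∘-bijection : (xs : List A) → Enumerates xs →
                    (β β⁻¹ : A → A) → (∀ v → β⁻¹ (β v) ≡ v) → (∀ w → β (β⁻¹ w) ≡ w) →
                    (f : A → ℕ) → ∑ xs (f ∘ β) ≡ ∑ xs f
    ∑-∘-bijection xs enum β β⁻¹ β⁻¹∘β β∘β⁻¹ f =
      trans (sym (∑-map β xs f)) (∑-resp-occurrences (map β xs) xs occ f)
      where
      occ : ∀ w → occurrences w (map β xs) ≡ occurrences w xs
      occ w = begin
        occurrences w (map β xs)           ≡⟨ ∑-map β xs _ ⟩
        ∑ xs (λ v → 𝟙 ⌊ β v ≟ᴬ w ⌋)        ≡⟨ ∑-cong xs (λ v → cong 𝟙 (T-extensional (moved v) (moved⁻¹ v))) ⟩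
        occurrences (β⁻¹ w) xs             ≡⟨ trans (enum (β⁻¹ w)) (sym (enum w)) ⟩
        occurrences w xs                   ∎
        where
        open ≡-Reasoning
        moved : ∀ v → T ⌊ β v ≟ᴬ w ⌋ → T ⌊ v ≟ᴬ β⁻¹ w ⌋
        moved v t = fromWitness (trans (sym (β⁻¹∘β v)) (cong β⁻¹ (toWitness t)))
        moved⁻¹ : ∀ v → T ⌊ v ≟ᴬ β⁻¹ w ⌋ → T ⌊ β v ≟ᴬ w ⌋
        moved⁻¹ v t = fromWitness (trans (cong β (toWitness t)) (β∘β⁻¹ w))

  open Multiplicity using (Enumerates)

  allFin-suc : ∀ n → allFin (suc n) ≡ zero ∷ map suc (allFin n)
  allFin-suc n = cong (zero ∷_) (sym (map-tabulate id suc))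

  allFin-enumerates : ∀ n → Enumerates _≟_ (allFin n)
  allFin-enumerates (suc n) w = begin
    occurrences w (allFin (suc n))                          ≡⟨ cong (occurrences w) (allFin-suc n) ⟩
    occurrences w (zero ∷ map suc (allFin n))              ≡⟨ cong (𝟙 ⌊ zero ≟ w ⌋ +_) (∑-map suc (allFin n) _) ⟩
    𝟙 ⌊ zero ≟ w ⌋ + ∑ (allFin n) (λ v → 𝟙 ⌊ suc v ≟ w ⌋)  ≡⟨ split w ⟩
    1                                                       ∎
    where
    open ≡-Reasoning
    open Multiplicity _≟_
    split : ∀ w → 𝟙 ⌊ zero ≟ w ⌋ + ∑ (allFin n) (λ v → 𝟙 ⌊ suc v ≟ w ⌋) ≡ 1
    split zero = cong suc (∑-ε (allFin n))
    split (suc w) = trans (∑-cong (allFin n) (λ v → cong 𝟙 (T-extensional (fromWitness ∘ suc-injective ∘ toWitness)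
                                                                           (fromWitness ∘ cong suc ∘ toWitness))))
                          (allFin-enumerates n w)

  bools-enumerate : Enumerates Bool._≟_ (true ∷ false ∷ [])
  bools-enumerate true = refl
  bools-enumerate false = refl

  module _ {A : Set} (_≟ᴬ_ : DecidableEquality A) where
    open Multiplicity

    vecs-enumerates : {xs : List A} → Enumerates _≟ᴬ_ xs → ∀ k → Enumerates (Vecₚ.≡-dec _≟ᴬ_) (vecs xs k)
    vecs-enumerates enum zero []ᵥ = refl
    vecs-enumerates {xs} enum (suc k) (w₀ ∷ᵥ w) = begin
      occurrences _≟ᵛ_ (w₀ ∷ᵥ w) (vecs xs (suc k))
        ≡⟨ ∑-concatMap _ xs _ ⟩
      ∑ xs (λ x → ∑ (map (x ∷ᵥ_) (vecs xs k)) (λ v → 𝟙 ⌊ v ≟ᵛ (w₀ ∷ᵥ w) ⌋))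
        ≡⟨ ∑-cong xs (λ x → ∑-map (x ∷ᵥ_) (vecs xs k) _) ⟩
      ∑ xs (λ x → ∑ (vecs xs k) (λ v → 𝟙 ⌊ (x ∷ᵥ v) ≟ᵛ (w₀ ∷ᵥ w) ⌋))
        ≡⟨ ∑-cong xs (λ x → ∑-cong (vecs xs k) (𝟙-∷-≟ x)) ⟩
      ∑ xs (λ x → ∑ (vecs xs k) (λ v → 𝟙 ⌊ x ≟ᴬ w₀ ⌋ * 𝟙 ⌊ v ≟ᵛ w ⌋))
        ≡⟨ ∑-cong xs (λ x → ∑-*ˡ (vecs xs k) (λ v → 𝟙 ⌊ v ≟ᵛ w ⌋) (𝟙 ⌊ x ≟ᴬ w₀ ⌋)) ⟩
      ∑ xs (λ x → 𝟙 ⌊ x ≟ᴬ w₀ ⌋ * occurrences _≟ᵛ_ w (vecs xs k))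
        ≡⟨ ∑-cong xs (λ x → cong (𝟙 ⌊ x ≟ᴬ w₀ ⌋ *_) (vecs-enumerates enum k w)) ⟩
      ∑ xs (λ x → 𝟙 ⌊ x ≟ᴬ w₀ ⌋ * 1)
        ≡⟨ ∑-cong xs (λ x → *-identityʳ _) ⟩
      occurrences _≟ᴬ_ w₀ xs
        ≡⟨ enum w₀ ⟩
      1 ∎
      where
      open ≡-Reasoning
      _≟ᵛ_ : ∀ {m} → DecidableEquality (Vec A m)
      _≟ᵛ_ = Vecₚ.≡-dec _≟ᴬ_
      𝟙-∷-≟ : ∀ x v → 𝟙 ⌊ (x ∷ᵥ v) ≟ᵛ (w₀ ∷ᵥ w) ⌋ ≡ 𝟙 ⌊ x ≟ᴬ w₀ ⌋ * 𝟙 ⌊ v ≟ᵛ w ⌋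
      𝟙-∷-≟ x v with x ≟ᴬ w₀ | v ≟ᵛ w | (x ∷ᵥ v) ≟ᵛ (w₀ ∷ᵥ w)
      ... | yes _    | yes _    | yes _   = refl
      ... | yes refl | yes refl | no ≢    = ⊥-elim (≢ refl)
      ... | yes _    | no ≢     | yes refl = ⊥-elim (≢ refl)
      ... | yes _    | no _     | no _    = refl
      ... | no ≢     | _        | yes refl = ⊥-elim (≢ refl)
      ... | no _     | _        | no _    = refl

  module Representatives {A : Set} (r : A → A → Bool)
                         (r-sym : ∀ {x y} → T (r x y) → T (r y x))
                         (r-trans : ∀ {x y z} → T (r x y) → T (r y z) → T (r x z)) where

    ∑-deduplicateᵇ : ∀ xs z → ∑ (deduplicateᵇ r xs) (λ y → 𝟙 (r y z)) ≡ 𝟙 (any (λ x → r x z) xs)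
    ∑-deduplicateᵇ [] z = refl
    ∑-deduplicateᵇ (x ∷ xs) z with r x z in xz
    ... | true = cong suc (begin
      ∑ (filter _ (deduplicateᵇ r xs)) (λ y → 𝟙 (r y z))       ≡⟨ ∑-filter _ (deduplicateᵇ r xs) _ ⟩
      ∑ (deduplicateᵇ r xs) (λ y → 𝟙 (not (r x y)) * 𝟙 (r y z)) ≡⟨ ∑-cong (deduplicateᵇ r xs) dropped ⟩
      ∑ (deduplicateᵇ r xs) (λ _ → 0)                           ≡⟨ ∑-ε (deduplicateᵇ r xs) ⟩
      0                                                         ∎)
      where
      open ≡-Reasoning
      dropped : ∀ y → 𝟙 (not (r x y)) * 𝟙 (r y z) ≡ 0
      dropped y with r y z in yz
      ... | false = *-zeroʳ (𝟙 (not (r x y)))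
      ... | true rewrite ≡true (r-trans (subst T (sym xz) tt) (r-sym (subst T (sym yz) tt))) = refl
    ... | false = begin
      ∑ (filter _ (deduplicateᵇ r xs)) (λ y → 𝟙 (r y z))       ≡⟨ ∑-filter _ (deduplicateᵇ r xs) _ ⟩
      ∑ (deduplicateᵇ r xs) (λ y → 𝟙 (not (r x y)) * 𝟙 (r y z)) ≡⟨ ∑-cong (deduplicateᵇ r xs) kept ⟩
      ∑ (deduplicateᵇ r xs) (λ y → 𝟙 (r y z))                   ≡⟨ ∑-deduplicateᵇ xs z ⟩
      𝟙 (any (λ x → r x z) xs)                                  ∎
      where
      open ≡-Reasoning
      kept : ∀ y → 𝟙 (not (r x y)) * 𝟙 (r y z) ≡ 𝟙 (r y z)
      kept y with r y z in yz
      ... | false = *-zeroʳ (𝟙 (not (r x y)))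
      ... | true rewrite ≡false {r x y} (λ t → subst T xz (r-trans t (subst T (sym yz) tt))) = refl

    ∑-deduplicateᵇ-∈ : (∀ y → T (r y y)) → ∀ {xs z} → z ∈ xs → ∑ (deduplicateᵇ r xs) (λ y → 𝟙 (r y z)) ≡ 1
    ∑-deduplicateᵇ-∈ r-refl {xs} {z} z∈xs =
      trans (∑-deduplicateᵇ xs z) (cong 𝟙 (≡true (any⁺ (λ x → r x z) (Any.map (λ { refl → r-refl z }) z∈xs))))

  -- Edges and graphs

  data _≈ᵉ_ {n} : Pair n → Pair n → Set where
    ≈ᵉ-same : ∀ {i j} → (i , j) ≈ᵉ (i , j)
    ≈ᵉ-swap : ∀ {i j} → (i , j) ≈ᵉ (j , i)

  Endo : ℕ → Set
  Endo n = Fin n → Fin n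

  actᵉ : ∀ {n} → Endo n → Pair n → Pair n
  actᵉ ρ (i , j) = ρ i , ρ j

  module _ {n : ℕ} where

    ==-refl : (i : Fin n) → T (i == i)
    ==-refl i = fromWitness refl

    sameEdgeᵇ⇒≈ᵉ : {e e' : Pair n} → T (sameEdgeᵇ e e') → e ≈ᵉ e'
    sameEdgeᵇ⇒≈ᵉ {i , j} {k , l} t with i ≟ k | j ≟ l | i ≟ l | j ≟ k
    ... | yes refl | yes refl | _        | _        = ≈ᵉ-same
    ... | _        | _        | yes refl | yes refl = ≈ᵉ-swap
    ... | no _     | _        | no _     | _        = ⊥-elim t
    ... | no _     | _        | yes _    | no _     = ⊥-elim t
    ... | yes _    | no _     | no _     | _        = ⊥-elim t
    ... | yes _    | no _     | yes _    | no _     = ⊥-elim t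

    ≈ᵉ⇒sameEdgeᵇ : {e e' : Pair n} → e ≈ᵉ e' → T (sameEdgeᵇ e e')
    ≈ᵉ⇒sameEdgeᵇ (≈ᵉ-same {i} {j}) = Equivalence.from T-∨ (inj₁ (Equivalence.from T-∧ (==-refl i , ==-refl j)))
    ≈ᵉ⇒sameEdgeᵇ (≈ᵉ-swap {i} {j}) =
      Equivalence.from (T-∨ {(i == j) ∧ (j == i)}) (inj₂ (Equivalence.from T-∧ (==-refl i , ==-refl j)))

    ≈ᵉ-refl : ∀ {e : Pair n} → e ≈ᵉ e
    ≈ᵉ-refl = ≈ᵉ-same

    ≈ᵉ-sym : ∀ {e e' : Pair n} → e ≈ᵉ e' → e' ≈ᵉ e
    ≈ᵉ-sym ≈ᵉ-same = ≈ᵉ-same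
    ≈ᵉ-sym ≈ᵉ-swap = ≈ᵉ-swap

    ≈ᵉ-trans : ∀ {e e' e'' : Pair n} → e ≈ᵉ e' → e' ≈ᵉ e'' → e ≈ᵉ e''
    ≈ᵉ-trans ≈ᵉ-same q = q
    ≈ᵉ-trans ≈ᵉ-swap ≈ᵉ-same = ≈ᵉ-swap
    ≈ᵉ-trans ≈ᵉ-swap ≈ᵉ-swap = ≈ᵉ-same

    ≈ᵉ-act : (ρ : Endo n) → ∀ {e e'} → e ≈ᵉ e' → actᵉ ρ e ≈ᵉ actᵉ ρ e'
    ≈ᵉ-act ρ ≈ᵉ-same = ≈ᵉ-same
    ≈ᵉ-act ρ ≈ᵉ-swap = ≈ᵉ-swap

    ≈ᵉ-act⁻ : {ρ : Endo n} → Injective _≡_ _≡_ ρ → ∀ {e e'} → actᵉ ρ e ≈ᵉ actᵉ ρ e' → e ≈ᵉ e'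
    ≈ᵉ-act⁻ {ρ} ρ-inj {i , j} {k , l} p = undo (actᵉ ρ (i , j)) (actᵉ ρ (k , l)) refl refl p
      where
      undo : ∀ e e' → e ≡ actᵉ ρ (i , j) → e' ≡ actᵉ ρ (k , l) → e ≈ᵉ e' → (i , j) ≈ᵉ (k , l)
      undo _ _ refl eq ≈ᵉ-same with ρ-inj (cong proj₁ eq) | ρ-inj (cong proj₂ eq)
      ... | refl | refl = ≈ᵉ-same
      undo _ _ refl eq ≈ᵉ-swap with ρ-inj (cong proj₁ eq) | ρ-inj (cong proj₂ eq)
      ... | refl | refl = ≈ᵉ-swap

    _∈ᵉ_ : Pair n → Graph n → Set
    e ∈ᵉ G = Any.Any (e ≈ᵉ_) G

    memᵇ⇒∈ᵉ : ∀ {e} G → T (memᵇ e G) → e ∈ᵉ G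
    memᵇ⇒∈ᵉ G t = Any.map sameEdgeᵇ⇒≈ᵉ (any⁻ _ G t)

    ∈ᵉ⇒memᵇ : ∀ {e G} → e ∈ᵉ G → T (memᵇ e G)
    ∈ᵉ⇒memᵇ {e} p = any⁺ (sameEdgeᵇ e) (Any.map ≈ᵉ⇒sameEdgeᵇ p)

    ∈⇒∈ᵉ : ∀ {e G} → e ∈ G → e ∈ᵉ G
    ∈⇒∈ᵉ = Any.map (λ { refl → ≈ᵉ-refl })

    ∈ᵉ-respˡ : ∀ {e e' G} → e ≈ᵉ e' → e' ∈ᵉ G → e ∈ᵉ G
    ∈ᵉ-respˡ e≈e' = Any.map (≈ᵉ-trans e≈e')

    _⊆ᵉ_ : Graph n → Graph n → Set
    G ⊆ᵉ H = ∀ {e} → e ∈ G → e ∈ᵉ H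

    ⊆ᵉ-∈ᵉ : ∀ {G H} → G ⊆ᵉ H → ∀ {e} → e ∈ᵉ G → e ∈ᵉ H
    ⊆ᵉ-∈ᵉ G⊆H e∈G with find e∈G
    ... | _ , f∈G , e≈f = ∈ᵉ-respˡ e≈f (G⊆H f∈G)

    ⊆ᵉ-refl : ∀ {G} → G ⊆ᵉ G
    ⊆ᵉ-refl = ∈⇒∈ᵉ

    ⊆ᵉ-trans : ∀ {G H K} → G ⊆ᵉ H → H ⊆ᵉ K → G ⊆ᵉ K
    ⊆ᵉ-trans G⊆H H⊆K = ⊆ᵉ-∈ᵉ H⊆K ∘ G⊆H

    _≈ᵍ_ : Graph n → Graph n → Set
    G ≈ᵍ H = G ⊆ᵉ H × H ⊆ᵉ G

    ≈ᵍ-refl : ∀ {G} → G ≈ᵍ G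
    ≈ᵍ-refl = ⊆ᵉ-refl , ⊆ᵉ-refl

    ≈ᵍ-sym : ∀ {G H} → G ≈ᵍ H → H ≈ᵍ G
    ≈ᵍ-sym (G⊆H , H⊆G) = H⊆G , G⊆H

    ≈ᵍ-trans : ∀ {G H K} → G ≈ᵍ H → H ≈ᵍ K → G ≈ᵍ K
    ≈ᵍ-trans (G⊆H , H⊆G) (H⊆K , K⊆H) = ⊆ᵉ-trans G⊆H H⊆K , ⊆ᵉ-trans K⊆H H⊆G

    allMemᵇ⇒⊆ᵉ : ∀ G H → T (all (λ e → memᵇ e H) G) → G ⊆ᵉ H
    allMemᵇ⇒⊆ᵉ G H t e∈G = memᵇ⇒∈ᵉ H (All.lookup (all⁺ _ G t) e∈G)

    ⊆ᵉ⇒allMemᵇ : ∀ G H → G ⊆ᵉ H → T (all (λ e → memᵇ e H) G)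
    ⊆ᵉ⇒allMemᵇ G H G⊆H = all⁻ _ (All.tabulate (∈ᵉ⇒memᵇ ∘ G⊆H))

    sameGraphᵇ⇒≈ᵍ : ∀ G H → T (sameGraphᵇ G H) → G ≈ᵍ H
    sameGraphᵇ⇒≈ᵍ G H t with Equivalence.to (T-∧ {all (λ e → memᵇ e H) G}) t
    ... | G⊆H , H⊆G = allMemᵇ⇒⊆ᵉ G H G⊆H , allMemᵇ⇒⊆ᵉ H G H⊆G

    ≈ᵍ⇒sameGraphᵇ : ∀ G H → G ≈ᵍ H → T (sameGraphᵇ G H)
    ≈ᵍ⇒sameGraphᵇ G H (G⊆H , H⊆G) = Equivalence.from T-∧ (⊆ᵉ⇒allMemᵇ G H G⊆H , ⊆ᵉ⇒allMemᵇ H G H⊆G)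

    ⊆ᵉ-act : (ρ : Endo n) → ∀ {G H} → G ⊆ᵉ H → act ρ G ⊆ᵉ act ρ H
    ⊆ᵉ-act ρ {G} G⊆H e∈ρG with ∈-map⁻ (actᵉ ρ) e∈ρG
    ... | e , e∈G , refl with find (G⊆H e∈G)
    ...   | f , f∈H , e≈f = Any.map (λ { refl → ≈ᵉ-act ρ e≈f }) (∈-map⁺ (actᵉ ρ) f∈H)

    ⊆ᵉ-act⁻ : {ρ : Endo n} → Injective _≡_ _≡_ ρ → ∀ {G H} → act ρ G ⊆ᵉ act ρ H → G ⊆ᵉ H
    ⊆ᵉ-act⁻ {ρ} ρ-inj {G} {H} ρG⊆ρH e∈G with find (ρG⊆ρH (∈-map⁺ (actᵉ ρ) e∈G))
    ... | _ , ρf∈ρH , ρe≈ρf with ∈-map⁻ (actᵉ ρ) ρf∈ρH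
    ...   | f , f∈H , refl = Any.map (λ { refl → ≈ᵉ-act⁻ ρ-inj ρe≈ρf }) f∈H

    ≈ᵍ-act : (ρ : Endo n) → ∀ {G H} → G ≈ᵍ H → act ρ G ≈ᵍ act ρ H
    ≈ᵍ-act ρ (G⊆H , H⊆G) = ⊆ᵉ-act ρ G⊆H , ⊆ᵉ-act ρ H⊆G

    ≈ᵍ-act⁻ : {ρ : Endo n} → Injective _≡_ _≡_ ρ → ∀ {G H} → act ρ G ≈ᵍ act ρ H → G ≈ᵍ H
    ≈ᵍ-act⁻ ρ-inj (ρG⊆ρH , ρH⊆ρG) = ⊆ᵉ-act⁻ ρ-inj ρG⊆ρH , ⊆ᵉ-act⁻ ρ-inj ρH⊆ρG

    act-∘ : (ρ σ : Endo n) (G : Graph n) → act (ρ ∘ σ) G ≡ act ρ (act σ G)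
    act-∘ ρ σ G = map-∘ G

    act-cong : {ρ σ : Endo n} → ρ ≗ σ → (G : Graph n) → act ρ G ≡ act σ G
    act-cong ρ≗σ = map-cong (λ e → cong₂ _,_ (ρ≗σ (proj₁ e)) (ρ≗σ (proj₂ e)))

    act-id : (G : Graph n) → act id G ≡ G
    act-id [] = refl
    act-id (e ∷ G) = cong (e ∷_) (act-id G)

  module _ {n : ℕ} where

    _≈ᵉ?_ : (e f : Pair n) → Dec (e ≈ᵉ f)
    e ≈ᵉ? f = map′ sameEdgeᵇ⇒≈ᵉ ≈ᵉ⇒sameEdgeᵇ (T? (sameEdgeᵇ e f))

    UniqueEdges : Graph n → Set
    UniqueEdges = AllPairs (λ e f → ¬ e ≈ᵉ f)

    removeᵉ : Pair n → Graph n → Graph n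
    removeᵉ e [] = []
    removeᵉ e (f ∷ G) with e ≈ᵉ? f
    ... | yes _ = G
    ... | no _ = f ∷ removeᵉ e G

    ∈-removeᵉ⁻ : ∀ e G {f} → f ∈ removeᵉ e G → f ∈ G
    ∈-removeᵉ⁻ e (h ∷ G) f∈ with e ≈ᵉ? h
    ∈-removeᵉ⁻ e (h ∷ G) f∈        | yes _ = there f∈
    ∈-removeᵉ⁻ e (h ∷ G) (here eq) | no _ = here eq
    ∈-removeᵉ⁻ e (h ∷ G) (there f∈) | no _ = there (∈-removeᵉ⁻ e G f∈)

    ∈-removeᵉ⁺ : ∀ e G {f} → f ∈ G → ¬ e ≈ᵉ f → f ∈ removeᵉ e G
    ∈-removeᵉ⁺ e (h ∷ G) f∈ e≉f with e ≈ᵉ? h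
    ∈-removeᵉ⁺ e (h ∷ G) (here refl) e≉f | yes e≈h = ⊥-elim (e≉f e≈h)
    ∈-removeᵉ⁺ e (h ∷ G) (there f∈)  e≉f | yes _ = f∈
    ∈-removeᵉ⁺ e (h ∷ G) (here eq)   e≉f | no _ = here eq
    ∈-removeᵉ⁺ e (h ∷ G) (there f∈)  e≉f | no _ = there (∈-removeᵉ⁺ e G f∈ e≉f)

    removeᵉ-removes : ∀ e {G} → UniqueEdges G → ∀ {f} → f ∈ removeᵉ e G → ¬ e ≈ᵉ f
    removeᵉ-removes e {h ∷ G} (h∉G ∷ G-unique) f∈ e≈f with e ≈ᵉ? h
    ... | yes e≈h = All.lookup h∉G f∈ (≈ᵉ-trans (≈ᵉ-sym e≈h) e≈f)
    removeᵉ-removes e {h ∷ G} (h∉G ∷ G-unique) (here refl) e≈f | no e≉h = e≉h e≈f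
    removeᵉ-removes e {h ∷ G} (h∉G ∷ G-unique) (there f∈) e≈f | no _ = removeᵉ-removes e G-unique f∈ e≈f

    removeᵉ-unique : ∀ e {G} → UniqueEdges G → UniqueEdges (removeᵉ e G)
    removeᵉ-unique e {[]} [] = []
    removeᵉ-unique e {h ∷ G} (h∉G ∷ G-unique) with e ≈ᵉ? h
    ... | yes _ = G-unique
    ... | no _ = All.tabulate (λ f∈ → All.lookup h∉G (∈-removeᵉ⁻ e G f∈)) ∷ removeᵉ-unique e G-unique

    length-removeᵉ : ∀ {e} G → e ∈ᵉ G → length G ≡ suc (length (removeᵉ e G))
    length-removeᵉ {e} (h ∷ G) e∈ with e ≈ᵉ? h
    length-removeᵉ (h ∷ G) e∈          | yes _ = refl
    length-removeᵉ (h ∷ G) (here e≈h)  | no e≉h = ⊥-elim (e≉h e≈h)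
    length-removeᵉ (h ∷ G) (there e∈)  | no _ = cong suc (length-removeᵉ G e∈)

    ≈ᵍ-removeᵉ : ∀ {e G G'} → UniqueEdges (e ∷ G) → UniqueEdges G' → (e ∷ G) ≈ᵍ G' → G ≈ᵍ removeᵉ e G'
    ≈ᵍ-removeᵉ {e} {G} {G'} (e∉G ∷ _) G'-unique (eG⊆G' , G'⊆eG) = G⊆ , ⊆G
      where
      G⊆ : G ⊆ᵉ removeᵉ e G'
      G⊆ f∈G with find (eG⊆G' (there f∈G))
      ... | f' , f'∈G' , f≈f' = ∈ᵉ-respˡ f≈f' (∈⇒∈ᵉ (∈-removeᵉ⁺ e G' f'∈G' e≉f'))
        where
        e≉f' : ¬ e ≈ᵉ f'
        e≉f' e≈f' = All.lookup e∉G f∈G (≈ᵉ-trans e≈f' (≈ᵉ-sym f≈f'))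
      ⊆G : removeᵉ e G' ⊆ᵉ G
      ⊆G f∈ with G'⊆eG (∈-removeᵉ⁻ e G' f∈)
      ... | here f≈e = ⊥-elim (removeᵉ-removes e G'-unique f∈ (≈ᵉ-sym f≈e))
      ... | there f∈G = f∈G

    length-≈ᵍ : ∀ {G G'} → UniqueEdges G → UniqueEdges G' → G ≈ᵍ G' → length G ≡ length G'
    length-≈ᵍ {[]} {[]} _ _ _ = refl
    length-≈ᵍ {[]} {f ∷ G'} _ _ (_ , G'⊆[]) with G'⊆[] (here refl)
    ... | ()
    length-≈ᵍ {e ∷ G} {G'} G-unique G'-unique G≈G' =
      trans (cong suc (length-≈ᵍ (AllPairs-tail G-unique) (removeᵉ-unique e G'-unique) (≈ᵍ-removeᵉ G-unique G'-unique G≈G')))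
            (sym (length-removeᵉ G' (proj₁ G≈G' (here refl))))

  -- The symmetric group

  injective⇒surjective : ∀ {n} {ρ : Endo n} → Injective _≡_ _≡_ ρ → ∀ y → ∃ λ x → ρ x ≡ y
  injective⇒surjective {suc m} {ρ} ρ-inj y with any? (λ x → ρ x ≟ y)
  ... | yes hit = hit
  ... | no miss = ⊥-elim (1+n≰n (injective⇒≤ punched-injective))
    where
    punched : Fin (suc m) → Fin m
    punched x = punchOut {i = y} {j = ρ x} (λ y≡ρx → miss (x , sym y≡ρx))
    punched-injective : Injective _≡_ _≡_ punched
    punched-injective eq = ρ-inj (punchOut-injective {i = y} _ _ eq)

  module Inverse {n} {ρ : Endo n} (ρ-inj : Injective _≡_ _≡_ ρ) where
    ρ⁻¹ : Endo n
    ρ⁻¹ y = proj₁ (injective⇒surjective ρ-inj y)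

    ρ∘ρ⁻¹ : ∀ y → ρ (ρ⁻¹ y) ≡ y
    ρ∘ρ⁻¹ y = proj₂ (injective⇒surjective ρ-inj y)

    ρ⁻¹∘ρ : ∀ x → ρ⁻¹ (ρ x) ≡ x
    ρ⁻¹∘ρ x = ρ-inj (ρ∘ρ⁻¹ (ρ x))

    ρ⁻¹-injective : Injective _≡_ _≡_ ρ⁻¹
    ρ⁻¹-injective {a} {b} eq = trans (sym (ρ∘ρ⁻¹ a)) (trans (cong ρ eq) (ρ∘ρ⁻¹ b))

  module _ {n : ℕ} where

    injectiveᵇ⇒Injective : (ρ : Endo n) → T (injectiveᵇ ρ) → Injective _≡_ _≡_ ρ
    injectiveᵇ⇒Injective ρ t {i} {j} ρi≡ρj
      with Equivalence.to (T-∨ {not (ρ i == ρ j)})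
             (All.lookup (all⁺ _ (allFin n) (All.lookup (all⁺ _ (allFin n) t) (∈-allFin i))) (∈-allFin j))
    ... | inj₁ ρi≢ρj rewrite ≡true (fromWitness {a? = ρ i ≟ ρ j} ρi≡ρj) = ⊥-elim ρi≢ρj
    ... | inj₂ i≡j = toWitness i≡j

    Injective⇒injectiveᵇ : (ρ : Endo n) → Injective _≡_ _≡_ ρ → T (injectiveᵇ ρ)
    Injective⇒injectiveᵇ ρ ρ-inj =
      all⁻ (λ i → all (λ j → not (ρ i == ρ j) ∨ (i == j)) (allFin n)) {allFin n} (All.tabulate (λ {i} _ →
        all⁻ (λ j → not (ρ i == ρ j) ∨ (i == j)) {allFin n} (All.tabulate (λ {j} _ → pair i j))))
      where
      pair : ∀ i j → T (not (ρ i == ρ j) ∨ (i == j))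
      pair i j with ρ i ≟ ρ j
      ... | yes ρi≡ρj = fromWitness (ρ-inj ρi≡ρj)
      ... | no _ = tt

    injectiveᵇ-cong : {ρ σ : Endo n} → ρ ≗ σ → injectiveᵇ ρ ≡ injectiveᵇ σ
    injectiveᵇ-cong {ρ} {σ} ρ≗σ = T-extensional
      (λ t → Injective⇒injectiveᵇ σ (λ eq → injectiveᵇ⇒Injective ρ t (trans (ρ≗σ _) (trans eq (sym (ρ≗σ _))))))
      (λ t → Injective⇒injectiveᵇ ρ (λ eq → injectiveᵇ⇒Injective σ t (trans (sym (ρ≗σ _)) (trans eq (ρ≗σ _)))))

    ∈-symmetricGroup⇒Injective : ∀ {ρ} → ρ ∈ symmetricGroup n → Injective _≡_ _≡_ ρ
    ∈-symmetricGroup⇒Injective {ρ} ρ∈Sₙ =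
      injectiveᵇ⇒Injective ρ (proj₂ (∈-filter⁻ (T? ∘ injectiveᵇ) {xs = maps n} ρ∈Sₙ))

    Injective⇒∈-symmetricGroup : {ρ : Endo n} → Injective _≡_ _≡_ ρ → ∃ λ π → π ∈ symmetricGroup n × π ≗ ρ
    Injective⇒∈-symmetricGroup {ρ} ρ-inj =
      lookup (tabulate ρ) ,
      ∈-filter⁺ (T? ∘ injectiveᵇ) (∈-map⁺ lookup tabulated) (Injective⇒injectiveᵇ _ π-inj) ,
      lookup∘tabulate ρ
      where
      tabulated : tabulate ρ ∈ vecs (allFin n) n
      tabulated = Multiplicity.Enumerates⇒∈ (Vecₚ.≡-dec _≟_) (vecs-enumerates _≟_ (allFin-enumerates n) n) (tabulate ρ)
      π-inj : Injective _≡_ _≡_ (lookup (tabulate ρ))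
      π-inj {i} {j} eq = ρ-inj (trans (sym (lookup∘tabulate ρ i)) (trans eq (lookup∘tabulate ρ j)))

    ∘-injective : {ρ σ : Endo n} → Injective _≡_ _≡_ ρ → Injective _≡_ _≡_ σ → Injective _≡_ _≡_ (ρ ∘ σ)
    ∘-injective ρ-inj σ-inj = σ-inj ∘ ρ-inj

    Invariant : (Endo n → ℕ) → Set
    Invariant f = ∀ {φ ψ} → φ ≗ ψ → f φ ≡ f ψ

    ∑-symmetricGroup : (f : Endo n → ℕ) →
                       ∑ (symmetricGroup n) f ≡ ∑ (vecs (allFin n) n) (λ v → 𝟙 (injectiveᵇ (lookup v)) * f (lookup v))
    ∑-symmetricGroup f = trans (∑-filter (T? ∘ injectiveᵇ) (maps n) f) (∑-map lookup (vecs (allFin n) n) _)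

    module Reindex (h h⁻¹ : Endo n → Endo n)
                   (h-cong : ∀ {φ ψ} → φ ≗ ψ → h φ ≗ h ψ) (h⁻¹-cong : ∀ {φ ψ} → φ ≗ ψ → h⁻¹ φ ≗ h⁻¹ ψ)
                   (h⁻¹∘h : ∀ φ → h⁻¹ (h φ) ≗ φ) (h∘h⁻¹ : ∀ φ → h (h⁻¹ φ) ≗ φ)
                   (h-injective : ∀ {φ} → Injective _≡_ _≡_ φ → Injective _≡_ _≡_ (h φ))
                   (h⁻¹-injective : ∀ {φ} → Injective _≡_ _≡_ φ → Injective _≡_ _≡_ (h⁻¹ φ)) where

      injectiveᵇ-h : ∀ φ → injectiveᵇ (h φ) ≡ injectiveᵇ φ
      injectiveᵇ-h φ = T-extensional
        (λ t → Injective⇒injectiveᵇ φ (λ eq → h⁻¹-injective (injectiveᵇ⇒Injective (h φ) t)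
                                          (trans (h⁻¹∘h φ _) (trans eq (sym (h⁻¹∘h φ _))))))
        (λ t → Injective⇒injectiveᵇ (h φ) (h-injective (injectiveᵇ⇒Injective φ t)))

      ∑-reindex : (f : Endo n → ℕ) → Invariant f → ∑ (symmetricGroup n) f ≡ ∑ (symmetricGroup n) (f ∘ h)
      ∑-reindex f f-inv = begin
        ∑ (symmetricGroup n) f    ≡⟨ ∑-symmetricGroup f ⟩
        ∑ V F                     ≡⟨ sym (Multiplicity.∑-∘-bijection (Vecₚ.≡-dec _≟_) V V-enum β β⁻¹ β⁻¹∘β β∘β⁻¹ F) ⟩
        ∑ V (F ∘ β)               ≡⟨ ∑-cong V F∘β ⟩
        ∑ V (λ v → 𝟙 (injectiveᵇ (lookup v)) * f (h (lookup v))) ≡⟨ sym (∑-symmetricGroup (f ∘ h)) ⟩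
        ∑ (symmetricGroup n) (f ∘ h) ∎
        where
        open ≡-Reasoning
        V : List (Vec (Fin n) n)
        V = vecs (allFin n) n
        V-enum : Enumerates (Vecₚ.≡-dec _≟_) V
        V-enum = vecs-enumerates _≟_ (allFin-enumerates n) n
        F : Vec (Fin n) n → ℕ
        F v = 𝟙 (injectiveᵇ (lookup v)) * f (lookup v)
        β β⁻¹ : Vec (Fin n) n → Vec (Fin n) n
        β v = tabulate (h (lookup v))
        β⁻¹ v = tabulate (h⁻¹ (lookup v))
        β⁻¹∘β : ∀ v → β⁻¹ (β v) ≡ v
        β⁻¹∘β v = trans (tabulate-cong (λ i → trans (h⁻¹-cong (lookup∘tabulate _) i) (h⁻¹∘h (lookup v) i))) (tabulate∘lookup v)
        β∘β⁻¹ : ∀ v → β (β⁻¹ v) ≡ v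
        β∘β⁻¹ v = trans (tabulate-cong (λ i → trans (h-cong (lookup∘tabulate _) i) (h∘h⁻¹ (lookup v) i))) (tabulate∘lookup v)
        F∘β : ∀ v → F (β v) ≡ 𝟙 (injectiveᵇ (lookup v)) * f (h (lookup v))
        F∘β v = cong₂ (λ b m → 𝟙 b * m) (trans (injectiveᵇ-cong (lookup∘tabulate _)) (injectiveᵇ-h (lookup v)))
                                         (f-inv (lookup∘tabulate _))

    module _ {σ : Endo n} (σ-inj : Injective _≡_ _≡_ σ) where
      open Inverse σ-inj renaming (ρ⁻¹ to σ⁻¹; ρ∘ρ⁻¹ to σ∘σ⁻¹; ρ⁻¹∘ρ to σ⁻¹∘σ; ρ⁻¹-injective to σ⁻¹-injective)

      ∑-symmetricGroup-∘ˡ : (f : Endo n → ℕ) → Invariant f →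
                            ∑ (symmetricGroup n) f ≡ ∑ (symmetricGroup n) (λ π → f (σ ∘ π))
      ∑-symmetricGroup-∘ˡ = Reindex.∑-reindex (σ ∘_) (σ⁻¹ ∘_) (λ φ≗ψ → cong σ ∘ φ≗ψ) (λ φ≗ψ → cong σ⁻¹ ∘ φ≗ψ)
        (λ φ → σ⁻¹∘σ ∘ φ) (λ φ → σ∘σ⁻¹ ∘ φ) (∘-injective σ-inj) (∘-injective σ⁻¹-injective)

      ∑-symmetricGroup-∘ʳ : (f : Endo n → ℕ) → Invariant f →
                            ∑ (symmetricGroup n) f ≡ ∑ (symmetricGroup n) (λ π → f (π ∘ σ))
      ∑-symmetricGroup-∘ʳ = Reindex.∑-reindex (_∘ σ) (_∘ σ⁻¹) (λ φ≗ψ → φ≗ψ ∘ σ) (λ φ≗ψ → φ≗ψ ∘ σ⁻¹)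
        (λ φ → cong φ ∘ σ∘σ⁻¹) (λ φ → cong φ ∘ σ⁻¹∘σ)
        (λ φ-inj → ∘-injective φ-inj σ-inj) (λ φ-inj → ∘-injective φ-inj σ⁻¹-injective)

  -- Orbits and stabilizers

  module _ {n : ℕ} where

    isomorphicᵇ⁻ : ∀ (G H : Graph n) → T (isomorphicᵇ G H) → ∃ λ π → π ∈ symmetricGroup n × act π G ≈ᵍ H
    isomorphicᵇ⁻ G H t with find (any⁻ _ (symmetricGroup n) t)
    ... | π , π∈Sₙ , πG≈H = π , π∈Sₙ , sameGraphᵇ⇒≈ᵍ (act π G) H πG≈H

    isomorphicᵇ⁺ : ∀ {G H : Graph n} {ρ : Endo n} → Injective _≡_ _≡_ ρ → act ρ G ≈ᵍ H → T (isomorphicᵇ G H)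
    isomorphicᵇ⁺ {G} {H} ρ-inj ρG≈H with Injective⇒∈-symmetricGroup ρ-inj
    ... | π , π∈Sₙ , π≗ρ = any⁺ _ (lose π∈Sₙ (≈ᵍ⇒sameGraphᵇ (act π G) H (subst (_≈ᵍ H) (sym (act-cong π≗ρ G)) ρG≈H)))

    isomorphicᵇ-refl : (G : Graph n) → T (isomorphicᵇ G G)
    isomorphicᵇ-refl G = isomorphicᵇ⁺ id (subst (_≈ᵍ G) (sym (act-id G)) ≈ᵍ-refl)

    isomorphicᵇ-sym : ∀ (G H : Graph n) → T (isomorphicᵇ G H) → T (isomorphicᵇ H G)
    isomorphicᵇ-sym G H t with isomorphicᵇ⁻ G H t
    ... | π , π∈Sₙ , πG≈H = isomorphicᵇ⁺ π⁻¹-injective (subst (act π⁻¹ H ≈ᵍ_) π⁻¹πG≡G (≈ᵍ-act π⁻¹ (≈ᵍ-sym πG≈H)))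
      where
      open Inverse (∈-symmetricGroup⇒Injective π∈Sₙ) renaming (ρ⁻¹ to π⁻¹; ρ⁻¹∘ρ to π⁻¹∘π; ρ⁻¹-injective to π⁻¹-injective)
      π⁻¹πG≡G : act π⁻¹ (act π G) ≡ G
      π⁻¹πG≡G = trans (sym (act-∘ π⁻¹ π G)) (trans (act-cong π⁻¹∘π G) (act-id G))

    isomorphicᵇ-trans : ∀ (G H K : Graph n) → T (isomorphicᵇ G H) → T (isomorphicᵇ H K) → T (isomorphicᵇ G K)
    isomorphicᵇ-trans G H K t u with isomorphicᵇ⁻ G H t | isomorphicᵇ⁻ H K u
    ... | π , π∈Sₙ , πG≈H | σ , σ∈Sₙ , σH≈K =
      isomorphicᵇ⁺ (∘-injective (∈-symmetricGroup⇒Injective σ∈Sₙ) (∈-symmetricGroup⇒Injective π∈Sₙ))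
                   (subst (_≈ᵍ K) (sym (act-∘ σ π G)) (≈ᵍ-trans (≈ᵍ-act σ πG≈H) σH≈K))

    #isos : Graph n → Graph n → ℕ
    #isos b c = ∑ (symmetricGroup n) (λ π → 𝟙 (sameGraphᵇ (act π b) c))

    length-stabilizer : (b : Graph n) → length (stabilizer b) ≡ #isos b b
    length-stabilizer b = length-filterᵇ _ (symmetricGroup n)

    #isos-invariant : (b c : Graph n) → Invariant (λ π → 𝟙 (sameGraphᵇ (act π b) c))
    #isos-invariant b c φ≗ψ = cong (λ K → 𝟙 (sameGraphᵇ K c)) (act-cong φ≗ψ b)

    #isos-act : (b c : Graph n) {σ : Endo n} → Injective _≡_ _≡_ σ → #isos b (act σ c) ≡ #isos b c
    #isos-act b c {σ} σ-inj = trans (∑-symmetricGroup-∘ˡ σ-inj _ (#isos-invariant b (act σ c)))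
                                    (∑-cong (symmetricGroup n) cancel-σ)
      where
      cancel-σ : ∀ π → 𝟙 (sameGraphᵇ (act (σ ∘ π) b) (act σ c)) ≡ 𝟙 (sameGraphᵇ (act π b) c)
      cancel-σ π rewrite act-∘ σ π b = cong 𝟙 (T-extensional
        (≈ᵍ⇒sameGraphᵇ (act π b) c ∘ ≈ᵍ-act⁻ σ-inj ∘ sameGraphᵇ⇒≈ᵍ (act σ (act π b)) (act σ c))
        (≈ᵍ⇒sameGraphᵇ (act σ (act π b)) (act σ c) ∘ ≈ᵍ-act σ ∘ sameGraphᵇ⇒≈ᵍ (act π b) c))

    #isos-≈ᵍ : (b c : Graph n) {ρ : Endo n} → Injective _≡_ _≡_ ρ → act ρ c ≈ᵍ b → #isos b c ≡ #isos c c
    #isos-≈ᵍ b c {ρ} ρ-inj ρc≈b = sym (trans (∑-symmetricGroup-∘ʳ ρ-inj _ (#isos-invariant c c))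
                                             (∑-cong (symmetricGroup n) through-b))
      where
      through-b : ∀ π → 𝟙 (sameGraphᵇ (act (π ∘ ρ) c) c) ≡ 𝟙 (sameGraphᵇ (act π b) c)
      through-b π rewrite act-∘ π ρ c = cong 𝟙 (T-extensional
        (λ t → ≈ᵍ⇒sameGraphᵇ (act π b) c (≈ᵍ-trans (≈ᵍ-act π (≈ᵍ-sym ρc≈b)) (sameGraphᵇ⇒≈ᵍ (act π (act ρ c)) c t)))
        (λ t → ≈ᵍ⇒sameGraphᵇ (act π (act ρ c)) c (≈ᵍ-trans (≈ᵍ-act π ρc≈b) (sameGraphᵇ⇒≈ᵍ (act π b) c t))))

    #isos-non-isomorphic : (b c : Graph n) → ¬ T (isomorphicᵇ b c) → #isos b c ≡ 0
    #isos-non-isomorphic b c b≇c = trans (∑-cong-∈ (symmetricGroup n) none) (∑-ε (symmetricGroup n))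
      where
      none : ∀ {π} → π ∈ symmetricGroup n → 𝟙 (sameGraphᵇ (act π b) c) ≡ 0
      none {π} π∈Sₙ = cong 𝟙 (≡false (b≇c ∘ isomorphicᵇ⁺ (∈-symmetricGroup⇒Injective π∈Sₙ) ∘ sameGraphᵇ⇒≈ᵍ (act π b) c))

    #isos-self-positive : (b : Graph n) → 1 ≤ #isos b b
    #isos-self-positive b with Injective⇒∈-symmetricGroup {ρ = id} id
    ... | π , π∈Sₙ , π≗id = ≤-trans (≤-reflexive (sym (cong 𝟙 (≡true πb≈b)))) (∑-≤ (symmetricGroup n) _ π∈Sₙ)
      where
      πb≈b : T (sameGraphᵇ (act π b) b)
      πb≈b = ≈ᵍ⇒sameGraphᵇ (act π b) b (subst (_≈ᵍ b) (sym (trans (act-cong π≗id b) (act-id b))) ≈ᵍ-refl)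

    #isos-by-isomorphism : (b a : Graph n) → #isos b a ≡ 𝟙 (isomorphicᵇ a b) * #isos a a
    #isos-by-isomorphism b a with isomorphicᵇ a b in a≅b
    ... | false = #isos-non-isomorphic b a (λ t → subst T a≅b (isomorphicᵇ-sym b a t))
    ... | true with isomorphicᵇ⁻ a b (subst T (sym a≅b) tt)
    ...   | ρ , ρ∈Sₙ , ρa≈b = trans (#isos-≈ᵍ b a (∈-symmetricGroup⇒Injective ρ∈Sₙ) ρa≈b) (sym (+-identityʳ _))

    module _ (b : Graph n) where
      private
        sameImageᵇ : Endo n → Endo n → Bool
        sameImageᵇ ρ σ = sameGraphᵇ (act ρ b) (act σ b)
        open Representatives sameImageᵇ
          (λ {ρ} {σ} t → ≈ᵍ⇒sameGraphᵇ (act σ b) (act ρ b) (≈ᵍ-sym (sameGraphᵇ⇒≈ᵍ (act ρ b) (act σ b) t)))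
          (λ {ρ} {σ} {υ} t u → ≈ᵍ⇒sameGraphᵇ (act ρ b) (act υ b)
                                 (≈ᵍ-trans (sameGraphᵇ⇒≈ᵍ (act ρ b) (act σ b) t) (sameGraphᵇ⇒≈ᵍ (act σ b) (act υ b) u)))
        one-rep : ∀ {π} → π ∈ symmetricGroup n → ∑ (cosetReps b) (λ ρ → 𝟙 (sameImageᵇ ρ π)) ≡ 1
        one-rep = ∑-deduplicateᵇ-∈ (λ ρ → ≈ᵍ⇒sameGraphᵇ (act ρ b) (act ρ b) ≈ᵍ-refl)

      ∈-cosetReps⇒Injective : ∀ {ρ} → ρ ∈ cosetReps b → Injective _≡_ _≡_ ρ
      ∈-cosetReps⇒Injective = ∈-symmetricGroup⇒Injective ∘ ∈-deduplicate⁻ _ (symmetricGroup n)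

      -- Orbit–stabilizer: the coset of each representative has |Stab(b)| elements.
      ∑-cosetReps : (F : Endo n → ℕ) → (∀ {ρ σ} → act ρ b ≈ᵍ act σ b → F ρ ≡ F σ) →
                    ∑ (cosetReps b) F * #isos b b ≡ ∑ (symmetricGroup n) F
      ∑-cosetReps F F-const = begin
        ∑ R F * #isos b b
          ≡⟨ sym (∑-*ʳ R F (#isos b b)) ⟩
        ∑ R (λ ρ → F ρ * #isos b b)
          ≡⟨ ∑-cong-∈ R (λ ρ∈R → cong (F _ *_) (sym (#isos-act b b (∈-cosetReps⇒Injective ρ∈R)))) ⟩
        ∑ R (λ ρ → F ρ * #isos b (act ρ b))
          ≡⟨ ∑-cong R (λ ρ → sym (∑-*ˡ Sₙ _ (F ρ))) ⟩
        ∑ R (λ ρ → ∑ Sₙ (λ π → F ρ * 𝟙 (sameGraphᵇ (act π b) (act ρ b))))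
          ≡⟨ ∑-cong R (λ ρ → ∑-cong Sₙ (swap ρ)) ⟩
        ∑ R (λ ρ → ∑ Sₙ (λ π → 𝟙 (sameImageᵇ ρ π) * F π))
          ≡⟨ ∑-comm R Sₙ _ ⟩
        ∑ Sₙ (λ π → ∑ R (λ ρ → 𝟙 (sameImageᵇ ρ π) * F π))
          ≡⟨ ∑-cong Sₙ (λ π → ∑-*ʳ R _ (F π)) ⟩
        ∑ Sₙ (λ π → ∑ R (λ ρ → 𝟙 (sameImageᵇ ρ π)) * F π)
          ≡⟨ ∑-cong-∈ Sₙ (λ π∈Sₙ → cong (_* F _) (one-rep π∈Sₙ)) ⟩
        ∑ Sₙ (λ π → 1 * F π)
          ≡⟨ ∑-cong Sₙ (λ π → +-identityʳ (F π)) ⟩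
        ∑ Sₙ F ∎
        where
        open ≡-Reasoning
        Sₙ = symmetricGroup n
        R = cosetReps b
        swap : ∀ ρ π → F ρ * 𝟙 (sameGraphᵇ (act π b) (act ρ b)) ≡ 𝟙 (sameImageᵇ ρ π) * F π
        swap ρ π with sameGraphᵇ (act π b) (act ρ b) in πb≈ρb | sameImageᵇ ρ π in ρb≈πb
        ... | false | false = *-zeroʳ (F ρ)
        ... | true  | true  = trans (*-identityʳ (F ρ)) (trans (F-const (sameGraphᵇ⇒≈ᵍ (act ρ b) (act π b) (subst T (sym ρb≈πb) tt)))
                                                               (sym (+-identityʳ (F π))))
        ... | true  | false = ⊥-elim (subst T ρb≈πb (≈ᵍ⇒sameGraphᵇ (act ρ b) (act π b)
                                (≈ᵍ-sym (sameGraphᵇ⇒≈ᵍ (act π b) (act ρ b) (subst T (sym πb≈ρb) tt)))))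
        ... | false | true  = ⊥-elim (subst T πb≈ρb (≈ᵍ⇒sameGraphᵇ (act π b) (act ρ b)
                                (≈ᵍ-sym (sameGraphᵇ⇒≈ᵍ (act ρ b) (act π b) (subst T (sym ρb≈πb) tt)))))

      ∑-cosetReps-orbit : (G : Graph n) → ∑ (cosetReps b) (λ σ → 𝟙 (sameGraphᵇ G (act σ b))) ≡ 𝟙 (isomorphicᵇ b G)
      ∑-cosetReps-orbit G with isomorphicᵇ b G in b≅G
      ... | false = trans (∑-cong-∈ (cosetReps b) none) (∑-ε (cosetReps b))
        where
        none : ∀ {σ} → σ ∈ cosetReps b → 𝟙 (sameGraphᵇ G (act σ b)) ≡ 0
        none {σ} σ∈R = cong 𝟙 (≡false (λ t → subst T b≅G
          (isomorphicᵇ⁺ (∈-cosetReps⇒Injective σ∈R) (≈ᵍ-sym (sameGraphᵇ⇒≈ᵍ G (act σ b) t)))))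
      ∑-cosetReps-orbit G | true with isomorphicᵇ⁻ b G (subst T (sym b≅G) tt)
      ...   | ρ , ρ∈Sₙ , ρb≈G = trans (∑-cong (cosetReps b) via-ρ) (one-rep ρ∈Sₙ)
        where
        via-ρ : ∀ σ → 𝟙 (sameGraphᵇ G (act σ b)) ≡ 𝟙 (sameImageᵇ σ ρ)
        via-ρ σ = cong 𝟙 (T-extensional
          (λ t → ≈ᵍ⇒sameGraphᵇ (act σ b) (act ρ b) (≈ᵍ-trans (≈ᵍ-sym (sameGraphᵇ⇒≈ᵍ G (act σ b) t)) (≈ᵍ-sym ρb≈G)))
          (λ t → ≈ᵍ⇒sameGraphᵇ G (act σ b) (≈ᵍ-trans (≈ᵍ-sym ρb≈G) (≈ᵍ-sym (sameGraphᵇ⇒≈ᵍ (act σ b) (act ρ b) t)))))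

  -- Subgraphs of g

  Subset : ℕ → Set
  Subset d = Vec Bool d

  _≟ˢ_ : ∀ {d} → DecidableEquality (Subset d)
  _≟ˢ_ = Vecₚ.≡-dec Bool._≟_

  subsets : ∀ d → List (Subset d)
  subsets d = vecs (true ∷ false ∷ []) d

  subsets-enumerate : ∀ d → Enumerates _≟ˢ_ (subsets d)
  subsets-enumerate d = vecs-enumerates Bool._≟_ bools-enumerate d

  support : ∀ {d} → Subset d → List (Fin d)
  support {d} S = filterᵇ (lookup S) (allFin d)

  filterᵇ-map : ∀ {A B : Set} (p : B → Bool) (h : A → B) xs → filterᵇ p (map h xs) ≡ map h (filterᵇ (p ∘ h) xs)
  filterᵇ-map p h [] = refl
  filterᵇ-map p h (x ∷ xs) with p (h x)
  ... | true = cong (h x ∷_) (filterᵇ-map p h xs)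
  ... | false = filterᵇ-map p h xs

  support-∷ : ∀ {d} b (S : Subset d) →
              support (b ∷ᵥ S) ≡ filterᵇ (lookup (b ∷ᵥ S)) (zero ∷ []) ++ map suc (support S)
  support-∷ {d} b S = trans (cong (filterᵇ (lookup (b ∷ᵥ S))) (allFin-suc d)) (lemma b)
    where
    lemma : ∀ b → filterᵇ (lookup (b ∷ᵥ S)) (zero ∷ map suc (allFin d)) ≡
                  filterᵇ (lookup (b ∷ᵥ S)) (zero ∷ []) ++ map suc (support S)
    lemma true = cong (zero ∷_) (filterᵇ-map (lookup (true ∷ᵥ S)) suc (allFin d))
    lemma false = filterᵇ-map (lookup (false ∷ᵥ S)) suc (allFin d)

  module Subgraphs {n d : ℕ} (τ : Fin d → Pair n) (τ-injective : ∀ k l → τ k ≈ᵉ τ l → k ≡ l) where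

    subgraph : Subset d → Graph n
    subgraph S = map τ (support S)

    g : Graph n
    g = edgesOf τ

    ∈-act-subgraph⁻ : ∀ π S {e} → e ∈ act π (subgraph S) → ∃ λ k → T (lookup S k) × e ≡ actᵉ π (τ k)
    ∈-act-subgraph⁻ π S e∈πS with ∈-map⁻ (actᵉ π) e∈πS
    ... | _ , τk∈S , refl with ∈-map⁻ τ τk∈S
    ...   | k , k∈S , refl = k , proj₂ (∈-filter⁻ (T? ∘ lookup S) {xs = allFin d} k∈S) , refl

    ∈-act-subgraph⁺ : ∀ π S k → T (lookup S k) → actᵉ π (τ k) ∈ act π (subgraph S)
    ∈-act-subgraph⁺ π S k k∈S = ∈-map⁺ (actᵉ π) (∈-map⁺ τ (∈-filter⁺ (T? ∘ lookup S) (∈-allFin k) k∈S))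

    ∈-act-g⁻ : ∀ {π e} → e ∈ act π g → ∃ λ k → e ≡ actᵉ π (τ k)
    ∈-act-g⁻ {π} e∈πg with ∈-map⁻ (actᵉ π) e∈πg
    ... | _ , τk∈g , refl with ∈-map⁻ τ τk∈g
    ...   | k , _ , refl = k , refl

    subgraph-⊆ᵉ : ∀ S → subgraph S ⊆ᵉ g
    subgraph-⊆ᵉ S τk∈S with ∈-map⁻ τ τk∈S
    ... | k , _ , refl = ∈⇒∈ᵉ (∈-map⁺ τ (∈-allFin k))

    trace : Endo n → Graph n → Subset d
    trace π h = tabulate (λ k → memᵇ (actᵉ π (τ k)) h)

    coveredᵇ : Graph n → Endo n → Bool
    coveredᵇ h π = all (λ e → memᵇ e (act π g)) h

    act-subgraph≈ᵍ⁻ : ∀ {π} → Injective _≡_ _≡_ π → ∀ {S h} →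
                      act π (subgraph S) ≈ᵍ h → S ≡ trace π h × h ⊆ᵉ act π g
    act-subgraph≈ᵍ⁻ {π} π-inj {S} {h} (πS⊆h , h⊆πS) =
      trans (sym (tabulate∘lookup S)) (tabulate-cong in-trace) , ⊆ᵉ-trans h⊆πS (⊆ᵉ-act π (subgraph-⊆ᵉ S))
      where
      in-trace : ∀ k → lookup S k ≡ memᵇ (actᵉ π (τ k)) h
      in-trace k with lookup S k in k∈S
      ... | true = sym (≡true (∈ᵉ⇒memᵇ (πS⊆h (∈-act-subgraph⁺ π S k (subst T (sym k∈S) tt)))))
      ... | false = sym (≡false (λ t → not-in-S (⊆ᵉ-∈ᵉ h⊆πS (memᵇ⇒∈ᵉ h t))))
        where
        not-in-S : ¬ actᵉ π (τ k) ∈ᵉ act π (subgraph S)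
        not-in-S πτk∈ᵉπS with find πτk∈ᵉπS
        ... | _ , e∈πS , πτk≈e with ∈-act-subgraph⁻ π S e∈πS
        ...   | j , j∈S , refl with τ-injective k j (≈ᵉ-act⁻ π-inj πτk≈e)
        ...     | refl = subst T k∈S j∈S

    act-subgraph≈ᵍ⁺ : ∀ {π S h} → S ≡ trace π h → h ⊆ᵉ act π g → act π (subgraph S) ≈ᵍ h
    act-subgraph≈ᵍ⁺ {π} {S} {h} refl h⊆πg = πS⊆h , h⊆πS
      where
      πS⊆h : act π (subgraph S) ⊆ᵉ h
      πS⊆h e∈πS with ∈-act-subgraph⁻ π S e∈πS
      ... | k , k∈S , refl = memᵇ⇒∈ᵉ h (subst T (lookup∘tabulate _ k) k∈S)
      h⊆πS : h ⊆ᵉ act π (subgraph S)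
      h⊆πS {e} e∈h with find (h⊆πg e∈h)
      ... | _ , f∈πg , e≈f with ∈-act-g⁻ f∈πg
      ...   | k , refl = Any.map (λ { refl → e≈f }) (∈-act-subgraph⁺ π S k k∈S)
        where
        k∈S : T (lookup S k)
        k∈S = subst T (sym (lookup∘tabulate _ k)) (∈ᵉ⇒memᵇ (∈ᵉ-respˡ (≈ᵉ-sym e≈f) (∈⇒∈ᵉ e∈h)))

    sameGraphᵇ-act-subgraph : ∀ {π} → Injective _≡_ _≡_ π → ∀ h S →
                              sameGraphᵇ (act π (subgraph S)) h ≡ ⌊ S ≟ˢ trace π h ⌋ ∧ coveredᵇ h π
    sameGraphᵇ-act-subgraph {π} π-inj h S = T-extensional
      (λ t → let (S≡ , h⊆πg) = act-subgraph≈ᵍ⁻ π-inj (sameGraphᵇ⇒≈ᵍ (act π (subgraph S)) h t)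
             in Equivalence.from T-∧ (fromWitness S≡ , ⊆ᵉ⇒allMemᵇ h (act π g) h⊆πg))
      (λ t → let (S≡ , h⊆πg) = Equivalence.to (T-∧ {⌊ S ≟ˢ trace π h ⌋}) t
             in ≈ᵍ⇒sameGraphᵇ (act π (subgraph S)) h (act-subgraph≈ᵍ⁺ (toWitness S≡) (allMemᵇ⇒⊆ᵉ h (act π g) h⊆πg)))

    ∑-subsets-onto : ∀ {π} → Injective _≡_ _≡_ π → ∀ h →
                     ∑ (subsets d) (λ S → 𝟙 (sameGraphᵇ (act π (subgraph S)) h)) ≡ 𝟙 (coveredᵇ h π)
    ∑-subsets-onto {π} π-inj h = begin
      ∑ (subsets d) (λ S → 𝟙 (sameGraphᵇ (act π (subgraph S)) h))
        ≡⟨ ∑-cong (subsets d) split ⟩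
      ∑ (subsets d) (λ S → 𝟙 ⌊ S ≟ˢ trace π h ⌋ * 𝟙 (coveredᵇ h π))
        ≡⟨ ∑-*ʳ (subsets d) _ _ ⟩
      Multiplicity.occurrences _≟ˢ_ (trace π h) (subsets d) * 𝟙 (coveredᵇ h π)
        ≡⟨ cong (_* 𝟙 (coveredᵇ h π)) (subsets-enumerate d _) ⟩
      1 * 𝟙 (coveredᵇ h π)
        ≡⟨ +-identityʳ _ ⟩
      𝟙 (coveredᵇ h π) ∎
      where
      open ≡-Reasoning
      split : ∀ S → 𝟙 (sameGraphᵇ (act π (subgraph S)) h) ≡ 𝟙 ⌊ S ≟ˢ trace π h ⌋ * 𝟙 (coveredᵇ h π)
      split S = trans (cong 𝟙 (sameGraphᵇ-act-subgraph π-inj h S)) (𝟙-∧ ⌊ S ≟ˢ trace π h ⌋ (coveredᵇ h π))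

    coveredᵇ-resp : ∀ h {ρ σ} → act ρ g ≈ᵍ act σ g → coveredᵇ h ρ ≡ coveredᵇ h σ
    coveredᵇ-resp h {ρ} {σ} (ρg⊆σg , σg⊆ρg) = T-extensional
      (λ t → ⊆ᵉ⇒allMemᵇ h (act σ g) (⊆ᵉ-trans (allMemᵇ⇒⊆ᵉ h (act ρ g) t) ρg⊆σg))
      (λ t → ⊆ᵉ⇒allMemᵇ h (act ρ g) (⊆ᵉ-trans (allMemᵇ⇒⊆ᵉ h (act σ g) t) σg⊆ρg))

    countIso-subsets : ∀ a → countIso a τ ≡ ∑ (subsets d) (λ S → 𝟙 (isomorphicᵇ a (subgraph S)))
    countIso-subsets a = trans (length-filterᵇ (isomorphicᵇ a) (map subgraph (subsets d))) (∑-map subgraph (subsets d) _)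

    #copies : Graph n → ℕ
    #copies h = ∑ (cosetReps g) (λ ρ → ∑ (subsets d) (λ S → 𝟙 (sameGraphᵇ (act ρ (subgraph S)) h)))

    #copies-* : ∀ a {σ} → Injective _≡_ _≡_ σ → #copies (act σ a) * #isos g g ≡ countIso a τ * length (stabilizer a)
    #copies-* a {σ} σ-inj = begin
      #copies h * #isos g g
        ≡⟨ cong (_* #isos g g) (∑-cong-∈ (cosetReps g) covered) ⟩
      ∑ (cosetReps g) (λ ρ → 𝟙 (coveredᵇ h ρ)) * #isos g g
        ≡⟨ ∑-cosetReps g _ (cong 𝟙 ∘ coveredᵇ-resp h) ⟩
      ∑ Sₙ (λ π → 𝟙 (coveredᵇ h π))
        ≡⟨ ∑-cong-∈ Sₙ (sym ∘ covered′) ⟩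
      ∑ Sₙ (λ π → ∑ (subsets d) (λ S → 𝟙 (sameGraphᵇ (act π (subgraph S)) h)))
        ≡⟨ ∑-comm Sₙ (subsets d) _ ⟩
      ∑ (subsets d) (λ S → #isos (subgraph S) h)
        ≡⟨ ∑-cong (subsets d) (λ S → #isos-act (subgraph S) a σ-inj) ⟩
      ∑ (subsets d) (λ S → #isos (subgraph S) a)
        ≡⟨ ∑-cong (subsets d) (λ S → #isos-by-isomorphism (subgraph S) a) ⟩
      ∑ (subsets d) (λ S → 𝟙 (isomorphicᵇ a (subgraph S)) * #isos a a)
        ≡⟨ ∑-*ʳ (subsets d) _ (#isos a a) ⟩
      ∑ (subsets d) (λ S → 𝟙 (isomorphicᵇ a (subgraph S))) * #isos a a
        ≡⟨ cong₂ _*_ (sym (countIso-subsets a)) (sym (length-stabilizer a)) ⟩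
      countIso a τ * length (stabilizer a) ∎
      where
      open ≡-Reasoning
      h = act σ a
      Sₙ = symmetricGroup n
      covered′ : ∀ {π} → π ∈ Sₙ → ∑ (subsets d) (λ S → 𝟙 (sameGraphᵇ (act π (subgraph S)) h)) ≡ 𝟙 (coveredᵇ h π)
      covered′ π∈Sₙ = ∑-subsets-onto (∈-symmetricGroup⇒Injective π∈Sₙ) h
      covered : ∀ {ρ} → ρ ∈ cosetReps g → ∑ (subsets d) (λ S → 𝟙 (sameGraphᵇ (act ρ (subgraph S)) h)) ≡ 𝟙 (coveredᵇ h ρ)
      covered ρ∈R = ∑-subsets-onto (∈-cosetReps⇒Injective g ρ∈R) h

    multiplicity : Graph n → ℕ
    multiplicity a = divℕ (countIso a τ * length (stabilizer a)) (length (stabilizer g))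

    multiplicity-#copies : ∀ a {σ} → Injective _≡_ _≡_ σ → multiplicity a ≡ #copies (act σ a)
    multiplicity-#copies a {σ} σ-inj rewrite length-stabilizer g =
      divide (#isos g g) (#isos-self-positive g) (#copies-* a σ-inj)
      where
      divide : ∀ N → 1 ≤ N → #copies (act σ a) * N ≡ countIso a τ * length (stabilizer a) →
               divℕ (countIso a τ * length (stabilizer a)) N ≡ #copies (act σ a)
      divide (suc k) _ eq rewrite sym eq = m*n/n≡m (#copies (act σ a)) (suc k)

    act-subgraph-unique : ∀ {π} → Injective _≡_ _≡_ π → ∀ S → UniqueEdges (act π (subgraph S))
    act-subgraph-unique {π} π-inj S = AllPairs.map⁺ (AllPairs.map⁺ (AllPairs.map distinct (filter⁺ (T? ∘ lookup S) (allFin⁺ d))))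
      where
      distinct : ∀ {k l} → k ≢ l → ¬ actᵉ π (τ k) ≈ᵉ actᵉ π (τ l)
      distinct k≢l πτk≈πτl = k≢l (τ-injective _ _ (≈ᵉ-act⁻ π-inj πτk≈πτl))

    -- the monomials of I(ḡ) once its products are expanded
    translates : List (Graph n)
    translates = concatMap (λ ρ → map (λ S → act ρ (subgraph S)) (subsets d)) (cosetReps g)

    -- the monomials of the right-hand side
    classOrbits : List (Graph n)
    classOrbits = concatMap (λ a → map (λ σ → act σ a) (cosetReps a)) (isoClassReps τ)

    ∈-translates⁻ : ∀ {G} → G ∈ translates → ∃ λ ρ → Injective _≡_ _≡_ ρ × ∃ λ S → G ≡ act ρ (subgraph S)
    ∈-translates⁻ G∈ with find (∈-concatMap⁻ _ {xs = cosetReps g} G∈)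
    ... | ρ , ρ∈R , G∈ρ with ∈-map⁻ (λ S → act ρ (subgraph S)) G∈ρ
    ...   | S , _ , G≡ = ρ , ∈-cosetReps⇒Injective g ρ∈R , S , G≡

    ∈-isoClassReps⁻ : ∀ {a} → a ∈ isoClassReps τ → ∃ λ S → a ≡ subgraph S
    ∈-isoClassReps⁻ a∈ with ∈-map⁻ subgraph (∈-deduplicate⁻ _ (subgraphs τ) a∈)
    ... | S , _ , a≡ = S , a≡

    ∈-classOrbits⁻ : ∀ {G} → G ∈ classOrbits → ∃ λ σ → Injective _≡_ _≡_ σ × ∃ λ S → G ≡ act σ (subgraph S)
    ∈-classOrbits⁻ G∈ with find (∈-concatMap⁻ _ {xs = isoClassReps τ} G∈)
    ... | a , a∈C , G∈σa with ∈-map⁻ (λ σ → act σ a) G∈σa | ∈-isoClassReps⁻ a∈C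
    ...   | σ , σ∈R , G≡ | S , refl = σ , ∈-cosetReps⇒Injective a σ∈R , S , G≡

    translate-unique : ∀ {G} → ∃ (λ π → Injective _≡_ _≡_ π × ∃ λ S → G ≡ act π (subgraph S)) → UniqueEdges G
    translate-unique (π , π-inj , S , refl) = act-subgraph-unique π-inj S

    ∑-classOrbits : ∀ {G} → G ∈ translates → ∑ classOrbits (λ y → 𝟙 (sameGraphᵇ G y)) ≡ 1
    ∑-classOrbits {G} G∈ with ∈-translates⁻ G∈
    ... | ρ , ρ-inj , S , refl = begin
      ∑ classOrbits (λ y → 𝟙 (sameGraphᵇ G y))
        ≡⟨ ∑-concatMap _ C _ ⟩
      ∑ C (λ a → ∑ (map (λ σ → act σ a) (cosetReps a)) (λ y → 𝟙 (sameGraphᵇ G y)))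
        ≡⟨ ∑-cong C (λ a → ∑-map _ (cosetReps a) _) ⟩
      ∑ C (λ a → ∑ (cosetReps a) (λ σ → 𝟙 (sameGraphᵇ G (act σ a))))
        ≡⟨ ∑-cong C (λ a → ∑-cosetReps-orbit a G) ⟩
      ∑ C (λ a → 𝟙 (isomorphicᵇ a G))
        ≡⟨ ∑-cong C (λ a → cong 𝟙 (T-extensional (to a) (from a))) ⟩
      ∑ C (λ a → 𝟙 (isomorphicᵇ a (subgraph S)))
        ≡⟨ one-class ⟩
      1 ∎
      where
      open ≡-Reasoning
      C = isoClassReps τ
      S≅G : T (isomorphicᵇ (subgraph S) G)
      S≅G = isomorphicᵇ⁺ {G = subgraph S} ρ-inj ≈ᵍ-refl
      to : ∀ a → T (isomorphicᵇ a G) → T (isomorphicᵇ a (subgraph S))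
      to a t = isomorphicᵇ-trans a G (subgraph S) t (isomorphicᵇ-sym (subgraph S) G S≅G)
      from : ∀ a → T (isomorphicᵇ a (subgraph S)) → T (isomorphicᵇ a G)
      from a t = isomorphicᵇ-trans a (subgraph S) G t S≅G
      open Representatives isomorphicᵇ (λ {a} {b} → isomorphicᵇ-sym a b) (λ {a} {b} {c} → isomorphicᵇ-trans a b c)
      one-class : ∑ C (λ a → 𝟙 (isomorphicᵇ a (subgraph S))) ≡ 1
      one-class = ∑-deduplicateᵇ-∈ isomorphicᵇ-refl {xs = subgraphs τ}
                    (∈-map⁺ subgraph (Multiplicity.Enumerates⇒∈ _≟ˢ_ (subsets-enumerate d) S))

    ∑-translates : ∀ {a σ} → σ ∈ cosetReps a → ∑ translates (λ G → 𝟙 (sameGraphᵇ G (act σ a))) ≡ multiplicity a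
    ∑-translates {a} {σ} σ∈R =
      trans (∑-concatMap _ (cosetReps g) _)
            (trans (∑-cong (cosetReps g) (λ ρ → ∑-map _ (subsets d) _))
                   (sym (multiplicity-#copies a (∈-cosetReps⇒Injective a σ∈R))))

-- The expansion in a commutative ring

module Expansion {c ℓ} (R : CommutativeRing c ℓ) where
  open Combinatorics
  open CommutativeRing R renaming (refl to ≈-refl; sym to ≈-sym; trans to ≈-trans; reflexive to ≈-reflexive) hiding (zero)
  open WithRing R
  open import Algebra.Definitions.RawMonoid +-rawMonoid using () renaming (_×_ to _·_)
  open import Algebra.Properties.Monoid.Mult +-monoid using (×-homo-+; ×-congʳ)
  open import Algebra.Properties.CommutativeMonoid.Mult +-commutativeMonoid using (×-distrib-+)
  open import Algebra.Properties.AbelianGroup +-abelianGroup using (⁻¹-∙-comm)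
  open import Algebra.Properties.Group +-group using (ε⁻¹≈ε)
  open import Algebra.Properties.Ring ring using (-‿distribˡ-*; -‿distribʳ-*)
  open ListSum +-commutativeMonoid using () renaming
    (∑ to ∑ᴿ; ∑-cong to ∑ᴿ-cong; ∑-cong-∈ to ∑ᴿ-cong-∈; ∑-map to ∑ᴿ-map;
     ∑-concatMap to ∑ᴿ-concatMap; ∑-comm to ∑ᴿ-comm)
  open import Relation.Binary.Reasoning.Setoid setoid

  module _ {A : Set} where
    sumR-map : (f : A → Carrier) (xs : List A) → sumR (map f xs) ≡ ∑ᴿ xs f
    sumR-map f [] = refl
    sumR-map f (x ∷ xs) = cong (f x +_) (sumR-map f xs)

    *-∑ᴿ : ∀ a (xs : List A) f → a * ∑ᴿ xs f ≈ ∑ᴿ xs (λ x → a * f x)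
    *-∑ᴿ a [] f = zeroʳ a
    *-∑ᴿ a (x ∷ xs) f = ≈-trans (distribˡ a (f x) (∑ᴿ xs f)) (+-congˡ (*-∑ᴿ a xs f))

    ×-∑ᴿ : ∀ k (xs : List A) f → k · ∑ᴿ xs f ≈ ∑ᴿ xs (λ x → k · f x)
    ×-∑ᴿ k [] f = ×-0# k
      where
      ×-0# : ∀ k → k · 0# ≈ 0#
      ×-0# ℕ.zero = ≈-refl
      ×-0# (ℕ.suc k) = ≈-trans (+-identityˡ _) (×-0# k)
    ×-∑ᴿ k (x ∷ xs) f = ≈-trans (×-distrib-+ (f x) (∑ᴿ xs f) k) (+-congˡ (×-∑ᴿ k xs f))

    ∑-× : ∀ (xs : List A) u y → ∑ xs u · y ≈ ∑ᴿ xs (λ x → u x · y)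
    ∑-× [] u y = ≈-refl
    ∑-× (x ∷ xs) u y = ≈-trans (×-homo-+ y (u x) (∑ xs u)) (+-congˡ (∑-× xs u y))

    -‿∑ᴿ : ∀ (xs : List A) f → - ∑ᴿ xs f ≈ ∑ᴿ xs (λ x → - f x)
    -‿∑ᴿ [] f = ε⁻¹≈ε
    -‿∑ᴿ (x ∷ xs) f = ≈-trans (≈-sym (⁻¹-∙-comm (f x) (∑ᴿ xs f))) (+-congˡ (-‿∑ᴿ xs f))

    signed-∑ᴿ : ∀ k (xs : List A) f → signed k (∑ᴿ xs f) ≈ ∑ᴿ xs (λ x → signed k (f x))
    signed-∑ᴿ ℕ.zero xs f = ≈-refl
    signed-∑ᴿ (ℕ.suc k) xs f = ≈-trans (-‿cong (signed-∑ᴿ k xs f)) (-‿∑ᴿ xs _)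

  signed-cong : ∀ k {a b} → a ≈ b → signed k a ≈ signed k b
  signed-cong ℕ.zero a≈b = a≈b
  signed-cong (ℕ.suc k) a≈b = -‿cong (signed-cong k a≈b)

  signed-*ʳ : ∀ k a y → signed k (a * y) ≈ a * signed k y
  signed-*ʳ ℕ.zero a y = ≈-refl
  signed-*ʳ (ℕ.suc k) a y = ≈-trans (-‿cong (signed-*ʳ k a y)) (-‿distribʳ-* a (signed k y))

  ×-‿ : ∀ q y → q · (- y) ≈ - (q · y)
  ×-‿ ℕ.zero y = ≈-sym ε⁻¹≈ε
  ×-‿ (ℕ.suc q) y = ≈-trans (+-congˡ (×-‿ q y)) (⁻¹-∙-comm y (q · y))

  signed-× : ∀ k q y → signed k (q · y) ≈ q · signed k y
  signed-× ℕ.zero q y = ≈-refl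
  signed-× (ℕ.suc k) q y = ≈-trans (-‿cong (signed-× k q y)) (≈-sym (×-‿ q (signed k y)))

  ∑ᴿ-regroup : {A B : Set} (xs : List A) (ys : List B) (rel : A → B → Bool) (f : A → Carrier) (h : B → Carrier) →
               (∀ {x} → x ∈ xs → ∑ ys (λ y → 𝟙 (rel x y)) ≡ 1) →
               (∀ {x y} → x ∈ xs → y ∈ ys → T (rel x y) → f x ≈ h y) →
               ∑ᴿ xs f ≈ ∑ᴿ ys (λ y → ∑ xs (λ x → 𝟙 (rel x y)) · h y)
  ∑ᴿ-regroup xs ys rel f h one f≈h = begin
    ∑ᴿ xs f
      ≈⟨ ∑ᴿ-cong-∈ xs (λ {x} x∈ → ≈-sym (≈-trans (×-congˡ′ (one x∈)) (+-identityʳ (f x)))) ⟩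
    ∑ᴿ xs (λ x → ∑ ys (λ y → 𝟙 (rel x y)) · f x)
      ≈⟨ ∑ᴿ-cong xs (λ x → ∑-× ys _ (f x)) ⟩
    ∑ᴿ xs (λ x → ∑ᴿ ys (λ y → 𝟙 (rel x y) · f x))
      ≈⟨ ∑ᴿ-cong-∈ xs (λ x∈ → ∑ᴿ-cong-∈ ys (λ y∈ → move x∈ y∈)) ⟩
    ∑ᴿ xs (λ x → ∑ᴿ ys (λ y → 𝟙 (rel x y) · h y))
      ≈⟨ ∑ᴿ-comm xs ys _ ⟩
    ∑ᴿ ys (λ y → ∑ᴿ xs (λ x → 𝟙 (rel x y) · h y))
      ≈⟨ ∑ᴿ-cong ys (λ y → ≈-sym (∑-× xs _ (h y))) ⟩
    ∑ᴿ ys (λ y → ∑ xs (λ x → 𝟙 (rel x y)) · h y) ∎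
    where
    ×-congˡ′ : ∀ {m k} {y} → m ≡ k → m · y ≈ k · y
    ×-congˡ′ refl = ≈-refl
    move : ∀ {x y} → x ∈ xs → y ∈ ys → 𝟙 (rel x y) · f x ≈ 𝟙 (rel x y) · h y
    move {x} {y} x∈ y∈ with rel x y in related
    ... | true = ×-congʳ 1 (f≈h x∈ y∈ (subst T (sym related) tt))
    ... | false = ≈-refl

  module Monomials {n} (x : Fin n → Fin n → Carrier) (x-sym : ∀ i j → x i j ≈ x j i) where
    open import Algebra.Properties.CommutativeSemigroup *-commutativeSemigroup using (x∙yz≈y∙xz)

    xᵉ : Pair n → Carrier
    xᵉ (i , j) = x i j

    xᵉ-resp : ∀ {e f} → e ≈ᵉ f → xᵉ e ≈ xᵉ f
    xᵉ-resp ≈ᵉ-same = ≈-refl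
    xᵉ-resp (≈ᵉ-swap {i} {j}) = x-sym i j

    monomial-removeᵉ : ∀ {e} G → e ∈ᵉ G → monomial x G ≈ xᵉ e * monomial x (removeᵉ e G)
    monomial-removeᵉ {e} (h ∷ G) e∈ with e ≈ᵉ? h
    monomial-removeᵉ (h ∷ G) e∈          | yes e≈h = *-congʳ (≈-sym (xᵉ-resp e≈h))
    monomial-removeᵉ (h ∷ G) (here e≈h)  | no e≉h = ⊥-elim (e≉h e≈h)
    monomial-removeᵉ {e} (h ∷ G) (there e∈) | no _ = begin
      xᵉ h * monomial x G                         ≈⟨ *-congˡ (monomial-removeᵉ G e∈) ⟩
      xᵉ h * (xᵉ e * monomial x (removeᵉ e G))    ≈⟨ x∙yz≈y∙xz (xᵉ h) (xᵉ e) _ ⟩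
      xᵉ e * (xᵉ h * monomial x (removeᵉ e G))    ∎

    monomial-≈ᵍ : ∀ {G G'} → UniqueEdges G → UniqueEdges G' → G ≈ᵍ G' → monomial x G ≈ monomial x G'
    monomial-≈ᵍ {[]} {[]} _ _ _ = ≈-refl
    monomial-≈ᵍ {[]} {f ∷ G'} _ _ (_ , G'⊆[]) with G'⊆[] (here refl)
    ... | ()
    monomial-≈ᵍ {e ∷ G} {G'} G-unique G'-unique G≈G' = begin
      xᵉ e * monomial x G                ≈⟨ *-congˡ (monomial-≈ᵍ (AllPairs-tail G-unique) (removeᵉ-unique e G'-unique)
                                                                (≈ᵍ-removeᵉ G-unique G'-unique G≈G')) ⟩
      xᵉ e * monomial x (removeᵉ e G')   ≈⟨ ≈-sym (monomial-removeᵉ G' (proj₁ G≈G' (here refl))) ⟩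
      monomial x G'                      ∎

    term : Graph n → Carrier
    term G = signed (length G) (monomial x G)

    term-≈ᵍ : ∀ {G G'} → UniqueEdges G → UniqueEdges G' → G ≈ᵍ G' → term G ≈ term G'
    term-≈ᵍ {G} {G'} G-unique G'-unique G≈G' rewrite length-≈ᵍ G-unique G'-unique G≈G' =
      signed-cong (length G') (monomial-≈ᵍ G-unique G'-unique G≈G')

  ∏ : ∀ {d} → (Fin d → Carrier) → List (Fin d) → Carrier
  ∏ f = foldr (λ k r → f k * r) 1#

  signed-∏ : ∀ {d} → (Fin d → Carrier) → Subset d → Carrier
  signed-∏ f S = signed (length (support S)) (∏ f (support S))

  signed-∏-false : ∀ {d} (f : Fin (ℕ.suc d) → Carrier) S → signed-∏ f (false ∷ᵥ S) ≡ signed-∏ (f ∘ suc) S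
  signed-∏-false f S rewrite support-∷ false S =
    cong₂ signed (length-map suc (support S)) (foldr-map _ suc 1# (support S))

  signed-∏-true : ∀ {d} (f : Fin (ℕ.suc d) → Carrier) S → signed-∏ f (true ∷ᵥ S) ≈ - f zero * signed-∏ (f ∘ suc) S
  signed-∏-true f S = begin
    signed-∏ f (true ∷ᵥ S)
      ≡⟨ cong (λ ks → signed (length ks) (∏ f ks)) (support-∷ true S) ⟩
    - signed (length (map suc s)) (f zero * ∏ f (map suc s))
      ≡⟨ cong₂ (λ l p → - signed l (f zero * p)) (length-map suc s) (foldr-map _ suc 1# s) ⟩
    - signed (length s) (f zero * ∏ (f ∘ suc) s)
      ≈⟨ -‿cong (signed-*ʳ (length s) (f zero) _) ⟩
    - (f zero * signed-∏ (f ∘ suc) S)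
      ≈⟨ -‿distribˡ-* (f zero) _ ⟩
    - f zero * signed-∏ (f ∘ suc) S ∎
    where
    s = support S

  ∏-1-expand : ∀ d (f : Fin d → Carrier) → ∏ (λ k → 1# + - f k) (allFin d) ≈ ∑ᴿ (subsets d) (signed-∏ f)
  ∏-1-expand ℕ.zero f = ≈-sym (+-identityʳ 1#)
  ∏-1-expand (ℕ.suc d) f = begin
    ∏ (λ k → 1# + - f k) (allFin (ℕ.suc d))
      ≡⟨ cong (∏ (λ k → 1# + - f k)) (allFin-suc d) ⟩
    (1# + - f zero) * ∏ (λ k → 1# + - f k) (map suc (allFin d))
      ≡⟨ cong ((1# + - f zero) *_) (foldr-map _ suc 1# (allFin d)) ⟩
    (1# + - f zero) * ∏ (λ k → 1# + - f (suc k)) (allFin d)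
      ≈⟨ *-congˡ (∏-1-expand d (f ∘ suc)) ⟩
    (1# + - f zero) * Σ₀
      ≈⟨ distribʳ Σ₀ 1# (- f zero) ⟩
    1# * Σ₀ + - f zero * Σ₀
      ≈⟨ +-comm _ _ ⟩
    - f zero * Σ₀ + 1# * Σ₀
      ≈⟨ +-cong (*-∑ᴿ (- f zero) Sᵈ _) (*-identityˡ Σ₀) ⟩
    ∑ᴿ Sᵈ (λ S → - f zero * signed-∏ (f ∘ suc) S) + Σ₀
      ≈⟨ +-cong (∑ᴿ-cong Sᵈ (≈-sym ∘ signed-∏-true f)) (≈-sym (∑ᴿ-cong Sᵈ (≈-reflexive ∘ signed-∏-false f))) ⟩
    ∑ᴿ Sᵈ (signed-∏ f ∘ (true ∷ᵥ_)) + ∑ᴿ Sᵈ (signed-∏ f ∘ (false ∷ᵥ_))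
      ≈⟨ ≈-sym (+-cong (∑ᴿ-map _ Sᵈ _) (≈-trans (+-identityʳ _) (∑ᴿ-map _ Sᵈ _))) ⟩
    ∑ᴿ (map (true ∷ᵥ_) Sᵈ) (signed-∏ f) + (∑ᴿ (map (false ∷ᵥ_) Sᵈ) (signed-∏ f) + 0#)
      ≈⟨ ≈-sym (∑ᴿ-concatMap (λ b → map (b ∷ᵥ_) Sᵈ) (true ∷ false ∷ []) (signed-∏ f)) ⟩
    ∑ᴿ (subsets (ℕ.suc d)) (signed-∏ f) ∎
    where
    Sᵈ = subsets d
    Σ₀ = ∑ᴿ Sᵈ (signed-∏ (f ∘ suc))

  module Identity {n d} (τ : Fin d → Pair n) (τ-injective : ∀ k l → τ k ≈ᵉ τ l → k ≡ l)
                  (x : Fin n → Fin n → Carrier) (x-sym : ∀ i j → x i j ≈ x j i) where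
    open Subgraphs τ τ-injective
    open Monomials x x-sym

    ∏-1-act-expand : ∀ ρ → foldr (λ e r → (1# + - x (ρ (proj₁ e)) (ρ (proj₂ e))) * r) 1# g ≈
                           ∑ᴿ (subsets d) (λ S → term (act ρ (subgraph S)))
    ∏-1-act-expand ρ = begin
      foldr (λ e r → (1# + - xᵉ (actᵉ ρ e)) * r) 1# (map τ (allFin d)) ≡⟨ foldr-map _ τ 1# (allFin d) ⟩
      ∏ (λ k → 1# + - xρτ k) (allFin d)                               ≈⟨ ∏-1-expand d xρτ ⟩
      ∑ᴿ (subsets d) (signed-∏ xρτ)                                   ≈⟨ ∑ᴿ-cong (subsets d) (≈-reflexive ∘ signed-∏≡term) ⟩
      ∑ᴿ (subsets d) (λ S → term (act ρ (subgraph S)))                ∎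
      where
      xρτ : Fin d → Carrier
      xρτ k = xᵉ (actᵉ ρ (τ k))
      signed-∏≡term : ∀ S → signed-∏ xρτ S ≡ term (act ρ (subgraph S))
      signed-∏≡term S = sym (cong₂ signed (trans (length-map (actᵉ ρ) (subgraph S)) (length-map τ (support S)))
                                          (trans (foldr-map _ (actᵉ ρ) 1# (subgraph S)) (foldr-map _ τ 1# (support S))))

    Ibar-expand : Ibar x τ ≈ ∑ᴿ translates term
    Ibar-expand = begin
      Ibar x τ
        ≡⟨ sumR-map _ (cosetReps g) ⟩
      ∑ᴿ (cosetReps g) (λ ρ → foldr (λ e r → (1# + - x (ρ (proj₁ e)) (ρ (proj₂ e))) * r) 1# g)
        ≈⟨ ∑ᴿ-cong (cosetReps g) ∏-1-act-expand ⟩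
      ∑ᴿ (cosetReps g) (λ ρ → ∑ᴿ (subsets d) (λ S → term (act ρ (subgraph S))))
        ≈⟨ ∑ᴿ-cong (cosetReps g) (λ ρ → ≈-sym (∑ᴿ-map _ (subsets d) term)) ⟩
      ∑ᴿ (cosetReps g) (λ ρ → ∑ᴿ (map (λ S → act ρ (subgraph S)) (subsets d)) term)
        ≈⟨ ≈-sym (∑ᴿ-concatMap _ (cosetReps g) term) ⟩
      ∑ᴿ translates term ∎

    orbit-sum : ∀ a → ∑ᴿ (cosetReps a) (λ σ → ∑ translates (λ G → 𝟙 (sameGraphᵇ G (act σ a))) · term (act σ a))
                      ≈ signed (length a) (multiplicity a · I x a)
    orbit-sum a = begin
      ∑ᴿ (cosetReps a) (λ σ → ∑ translates (λ G → 𝟙 (sameGraphᵇ G (act σ a))) · term (act σ a))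
        ≈⟨ ∑ᴿ-cong-∈ (cosetReps a) (λ {σ} σ∈ → ≈-reflexive (cong₂ _·_ (∑-translates {a} σ∈)
                                      (cong (λ l → signed l (monomial x (act σ a))) (length-map _ a)))) ⟩
      ∑ᴿ (cosetReps a) (λ σ → multiplicity a · signed (length a) (monomial x (act σ a)))
        ≈⟨ ∑ᴿ-cong (cosetReps a) (λ σ → ≈-sym (signed-× (length a) (multiplicity a) _)) ⟩
      ∑ᴿ (cosetReps a) (λ σ → signed (length a) (multiplicity a · monomial x (act σ a)))
        ≈⟨ ≈-sym (signed-∑ᴿ (length a) (cosetReps a) _) ⟩
      signed (length a) (∑ᴿ (cosetReps a) (λ σ → multiplicity a · monomial x (act σ a)))
        ≈⟨ signed-cong (length a) (≈-sym (×-∑ᴿ (multiplicity a) (cosetReps a) _)) ⟩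
      signed (length a) (multiplicity a · ∑ᴿ (cosetReps a) (λ σ → monomial x (act σ a)))
        ≡⟨ cong (λ s → signed (length a) (multiplicity a · s)) (sym (sumR-map _ (cosetReps a))) ⟩
      signed (length a) (multiplicity a · I x a) ∎

    rhs-expand : ∑ᴿ classOrbits (λ y → ∑ translates (λ G → 𝟙 (sameGraphᵇ G y)) · term y) ≈ rhs x τ
    rhs-expand = begin
      ∑ᴿ classOrbits (λ y → ∑ translates (λ G → 𝟙 (sameGraphᵇ G y)) · term y)
        ≈⟨ ∑ᴿ-concatMap _ C _ ⟩
      ∑ᴿ C (λ a → ∑ᴿ (map (λ σ → act σ a) (cosetReps a)) (λ y → ∑ translates (λ G → 𝟙 (sameGraphᵇ G y)) · term y))
        ≈⟨ ∑ᴿ-cong C (λ a → ≈-trans (∑ᴿ-map _ (cosetReps a) _) (orbit-sum a)) ⟩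
      ∑ᴿ C (λ a → signed (length a) (multiplicity a · I x a))
        ≡⟨ sym (sumR-map _ C) ⟩
      rhs x τ ∎
      where
      C = isoClassReps τ

    Ibar≈rhs : Ibar x τ ≈ rhs x τ
    Ibar≈rhs = begin
      Ibar x τ             ≈⟨ Ibar-expand ⟩
      ∑ᴿ translates term   ≈⟨ ∑ᴿ-regroup translates classOrbits sameGraphᵇ term term ∑-classOrbits same-term ⟩
      ∑ᴿ classOrbits (λ y → ∑ translates (λ G → 𝟙 (sameGraphᵇ G y)) · term y) ≈⟨ rhs-expand ⟩
      rhs x τ              ∎
      where
      same-term : ∀ {G y} → G ∈ translates → y ∈ classOrbits → T (sameGraphᵇ G y) → term G ≈ term y
      same-term {G} {y} G∈ y∈ t = term-≈ᵍ (translate-unique (∈-translates⁻ G∈)) (translate-unique (∈-classOrbits⁻ y∈))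
                                          (sameGraphᵇ⇒≈ᵍ G y t)

lemma8 : ∀ {c ℓ} (R : CommutativeRing c ℓ) (n d : ℕ) (τ : Fin d → Pair n) →
         (∀ k → proj₁ (τ k) ≢ proj₂ (τ k)) →
         (∀ k l → T (sameEdgeᵇ (τ k) (τ l)) → k ≡ l) →
         (x : Fin n → Fin n → CommutativeRing.Carrier R) →
         (∀ i j → CommutativeRing._≈_ R (x i j) (x j i)) →
         CommutativeRing._≈_ R (WithRing.Ibar R x τ) (WithRing.rhs R x τ)
lemma8 R n d τ _ τ-injective x x-sym =
  Expansion.Identity.Ibar≈rhs R τ (λ k l → τ-injective k l ∘ Combinatorics.≈ᵉ⇒sameEdgeᵇ) x x-sym
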